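{- Let $n\geq 2$ be an integer, let $\phi=\frac{1+\sqrt{5}}{2}$ and $x_n=\phi^{n-1}+(-1)^{n-1}\phi^{ -(n-1)}$. The number of tilings of the $n\times n$ square border by $1\times 1$ and $2\times 1$ cuisenaire rods, distinct up to rotational symmetry, is $$\frac{1}{4}\left[x_n^4+(1+4(-1)^n)x_n^2+2x_n+2(1+(-1)^n)\right].$$
   Context: The $n\times n$ square border is the region of unit grid cells obtained from an $n\times n$ square of unit cells by removing the central $(n-2)\times(n-2)$ square of cells (for $n=2$ nothing is removed). A tiling of it by $1\times 1$ and $2\times 1$ cuisenaire rods is a covering of all its cells, without overlap, by grid-aligned tiles each of which is a single cell or two edge-adjacent cells of the region (a $2\times 1$ rod may be placed horizontally or vertically). The cyclic group $C_4$ of rotations of the square by multiples of $90^\circ$ about its centre acts on the set of such tilings; "distinct up to rotational symmetry" means the number of orbits of this action. -}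

module Defs where

open import Data.Nat using (ℕ; zero; suc; _+_; _∸_)
open import Data.Fin using (Fin; toℕ; opposite)
open import Data.Product using (Σ; ∃; _×_; _,_; proj₁; proj₂)
open import Data.Sum using (_⊎_)
open import Relation.Binary.PropositionalEquality using (_≡_)
open import Data.Integer as ℤ using (ℤ; +_)
open import Relation.Nullary using (¬_)

-- A unit cell of the n×n grid: (row , column).
Cell : ℕ → Set
Cell n = Fin n × Fin n

OnEdge : ∀ {n} → Fin n → Set
OnEdge {n} i = (toℕ i ≡ 0) ⊎ (toℕ i ≡ n ∸ 1)

InBorder : ∀ {n} → Cell n → Set
InBorder (i , j) = OnEdge i ⊎ OnEdge j

Neighbour : ∀ {n} → Fin n → Fin n → Set
Neighbour a b = (toℕ b ≡ suc (toℕ a)) ⊎ (toℕ a ≡ suc (toℕ b))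

Adjacent : ∀ {n} → Cell n → Cell n → Set
Adjacent (i , j) (i' , j') = (i ≡ i' × Neighbour j j') ⊎ (j ≡ j' × Neighbour i i')

-- A tiling by 1×1 and 2×1 rods, encoded by the "partner" map:
-- for a border cell c, partner c ≡ c means c is covered by a 1×1 rod;
-- otherwise partner c is the other cell of the 2×1 rod covering c,
-- which must be an edge-adjacent border cell, and partner is an involution
-- (so rods do not overlap and cover everything).  Cells outside the border
-- are not part of the region; the map is normalised to be the identity there.
record Tiling (n : ℕ) : Set where
  field
    partner    : Cell n → Cell n
    outside    : ∀ c → ¬ InBorder c → partner c ≡ c
    rod        : ∀ c → InBorder c →
                   (partner c ≡ c) ⊎ (InBorder (partner c) × Adjacent c (partner c))
    involutive : ∀ c → InBorder c → partner (partner c) ≡ c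
open Tiling public

rot : ∀ {n} → Cell n → Cell n
rot (i , j) = (j , opposite i)

rot⁻¹ : ∀ {n} → Cell n → Cell n
rot⁻¹ (i , j) = (opposite j , i)

iter : ∀ {A : Set} → ℕ → (A → A) → A → A
iter zero    f x = x
iter (suc k) f x = f (iter k f x)

RotatedBy : ∀ {n} → Fin 4 → Tiling n → Tiling n → Set
RotatedBy {n} k t t' =
  ∀ c → partner t' c ≡ iter (toℕ k) rot (partner t (iter (toℕ k) rot⁻¹ c))

SameOrbit : ∀ {n} → Tiling n → Tiling n → Set
SameOrbit t t' = Σ (Fin 4) λ k → RotatedBy k t t'

-- "The number of C₄-orbits of tilings of the n×n border is m":
-- a family of m tilings meeting every orbit exactly once
-- (i.e. a bijection between Fin m and the set of orbits).
NumOrbits : ℕ → ℕ → Set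
NumOrbits n m =
  Σ (Fin m → Tiling n) λ rep →
    (∀ t → ∃ λ i → SameOrbit t (rep i)) ×
    (∀ i j → SameOrbit (rep i) (rep j) → i ≡ j)

-- Lucas numbers: L₀ = 2, L₁ = 1, L_{k+2} = L_{k+1} + L_k;
-- L_k = φ^k + (-1)^k φ^{-k}, so x_n = L_{n-1}.
lucas : ℕ → ℕ
lucas zero = 2
lucas (suc zero) = 1
lucas (suc (suc k)) = lucas (suc k) + lucas k

x : ℕ → ℤ
x n = + lucas (n ∸ 1)

sgn : ℕ → ℤ
sgn n = ℤ.-1ℤ ℤ.^ n

-- x_n^4 + (1 + 4(-1)^n) x_n^2 + 2 x_n + 2(1 + (-1)^n)   (four times the count)
formula : ℕ → ℤ
formula n = x n ℤ.^ 4 ℤ.+ (ℤ.1ℤ ℤ.+ + 4 ℤ.* sgn n) ℤ.* x n ℤ.^ 2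
            ℤ.+ + 2 ℤ.* x n ℤ.+ + 2 ℤ.* (ℤ.1ℤ ℤ.+ sgn n)

-- Number the 4(n − 1) border cells cyclically.  A tiling is the same as a cyclic binary
-- word of length 4(n − 1) without two adjacent ones (a one marks a cell forming a domino
-- with the next cell), and the quarter turn shifts this word by n − 1 letters.  Cut the
-- word into four blocks of length m = n − 1.  By the transfer-matrix method the words
-- fixed by the identity, the half turn and the quarter turn number tr T⁴, tr T² and tr T,
-- where T = Qᵐ and Q = [[1,1],[1,0]].  Since Q² = Q + I and det Q = −1, tr T is the Lucas
-- number Lₘ = xₙ and det T = (−1)ᵐ, so tr T² = xₙ² + 2(−1)ⁿ and tr T⁴ = (tr T²)² − 2.
-- Choosing in each orbit the word of least index in a fixed enumeration, Burnside's lemma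
-- for C₄ gives 4 · #orbits = tr T⁴ + tr T² + 2 tr T, which is the formula.

module Submission where

open import Defs

module _ where

  open import Data.Integer using (+_; _+_; _-_; _*_; 1ℤ; -1ℤ)
  open import Data.Integer.Properties using (+-identityʳ)
  open import Data.Integer.Tactic.RingSolver using (solve-∀)
  open import Data.Nat using (zero; suc)
  open import Relation.Binary.PropositionalEquality using (_≡_; refl; cong; trans)

  sgn-square : ∀ m → sgn m * sgn m ≡ 1ℤ
  sgn-square zero    = refl
  sgn-square (suc m) = trans (lemma (sgn m)) (sgn-square m)
    where
    lemma : ∀ s → (-1ℤ * s) * (-1ℤ * s) ≡ s * s
    lemma = solve-∀

  orbit-polynomial : ∀ t δ → δ * δ ≡ 1ℤ →
    (t * t - + 2 * δ) * (t * t - + 2 * δ) - + 2 * (δ * δ) + (t * t - + 2 * δ) + + 2 * t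
    ≡ t * (t * (t * (t * 1ℤ))) + (1ℤ + + 4 * (-1ℤ * δ)) * (t * (t * 1ℤ)) + + 2 * t + + 2 * (1ℤ + -1ℤ * δ)
  orbit-polynomial t δ δ²≡1 = trans (lemma t δ) (trans (cong (λ s → rhs + + 2 * (s - 1ℤ)) δ²≡1) (+-identityʳ rhs))
    where
    rhs = t * (t * (t * (t * 1ℤ))) + (1ℤ + + 4 * (-1ℤ * δ)) * (t * (t * 1ℤ)) + + 2 * t + + 2 * (1ℤ + -1ℤ * δ)
    lemma : ∀ t δ →
      (t * t - + 2 * δ) * (t * t - + 2 * δ) - + 2 * (δ * δ) + (t * t - + 2 * δ) + + 2 * t
      ≡ t * (t * (t * (t * 1ℤ))) + (1ℤ + + 4 * (-1ℤ * δ)) * (t * (t * 1ℤ)) + + 2 * t + + 2 * (1ℤ + -1ℤ * δ)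
        + + 2 * (δ * δ - 1ℤ)
    lemma = solve-∀

module _ where

  open import Data.Bool using (Bool; true; false; _∧_; not; if_then_else_; T)
  open import Data.Bool.Properties using (∧-assoc; ∧-comm; ∧-conicalˡ; ∧-conicalʳ; not-injective; T-∧; T-≡) renaming (_≟_ to _≟ᵇ_)
  open import Data.Empty using (⊥-elim)
  open import Data.Fin using (Fin; zero; suc; toℕ; opposite; inject₁; fromℕ; lower₁)
  import Data.Fin.Properties as Fin
  open import Data.Fin.Patterns using (0F; 1F; 2F; 3F)
  open import Data.Fin.Relation.Unary.Top using (View; view; ‵fromℕ; ‵inject₁; view-fromℕ; view-inject₁)
  open import Data.Integer using (ℤ)
  import Data.Integer as ℤ
  open import Data.Integer.Properties using (pos-+; pos-*)
  open import Data.Integer.Tactic.RingSolver using () renaming (solve-∀ to ℤ-solve-∀)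
  open import Data.List using (List; []; _∷_; _++_; map; length; filter; cartesianProduct)
  import Data.List as List
  open import Data.List.Membership.Propositional using (_∈_)
  open import Data.List.Membership.Propositional.Properties using (∈-map⁺; ∈-map⁻; ∈-++⁺ˡ; ∈-++⁺ʳ; ∈-lookup; ∈-filter⁺; ∈-filter⁻; ∈-cartesianProduct⁺)
  open import Data.List.Relation.Unary.All using (All; []; _∷_)
  import Data.List.Relation.Unary.All as All
  open import Data.List.Relation.Unary.AllPairs using ([]; _∷_)
  open import Data.List.Relation.Unary.Any using (here; there)
  import Data.List.Relation.Unary.Any as Any
  open import Data.List.Relation.Unary.Any.Properties using (lookup-index)
  open import Data.List.Relation.Unary.Unique.Propositional using (Unique)
  import Data.List.Relation.Unary.Unique.Propositional.Properties as Unique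
  open import Data.Nat using (ℕ; zero; suc; _+_; _*_; _∸_; _≤_; _⊓_; _≡ᵇ_)
  import Data.Nat.Properties as ℕ
  open import Data.Nat.Properties using (+-assoc; +-identityʳ; *-assoc; *-comm; *-identityʳ; *-zeroʳ; *-distribˡ-+)
  open import Data.Nat.Tactic.RingSolver using (solve-∀)
  open import Data.Product using (Σ; ∃-syntax; _×_; _,_; proj₁; proj₂)
  import Data.Product.Properties as Product
  open import Data.Sum using (_⊎_; inj₁; inj₂)
  import Data.Sum as Sum
  open import Data.Vec using (Vec; []; _∷_; last; lookup; tabulate)
  import Data.Vec.Properties as Vec
  open import Function using (_∘_; _⇔_; mk⇔; Equivalence)
  open import Relation.Binary.Definitions using (DecidableEquality)
  open import Relation.Binary.PropositionalEquality
  open import Relation.Nullary using (¬_; Dec; yes; no; does)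
  open import Relation.Nullary.Decidable using (T?; dec-true; dec-false; does-⇔; _×-dec_; _⊎-dec_)

  -- Indicators and finite sums

  ⟦_⟧ : Bool → ℕ
  ⟦ true ⟧  = 1
  ⟦ false ⟧ = 0

  ⟦∧⟧ : ∀ p q → ⟦ p ∧ q ⟧ ≡ ⟦ p ⟧ * ⟦ q ⟧
  ⟦∧⟧ true  q = sym (+-identityʳ ⟦ q ⟧)
  ⟦∧⟧ false q = refl

  𝟙 : ∀ {P : Set} → Dec P → ℕ
  𝟙 P? = ⟦ does P? ⟧

  𝟙-⇔ : ∀ {P R : Set} (P? : Dec P) (R? : Dec R) → P ⇔ R → 𝟙 P? ≡ 𝟙 R?
  𝟙-⇔ P? R? P⇔R = cong ⟦_⟧ (does-⇔ P⇔R P? R?)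

  𝟙-× : ∀ {P R : Set} (P? : Dec P) (R? : Dec R) → 𝟙 (P? ×-dec R?) ≡ 𝟙 P? * 𝟙 R?
  𝟙-× P? R? = ⟦∧⟧ (does P?) (does R?)

  variable
    A B : Set
    m : ℕ
    xs : List A
    f g : A → ℕ

  ∑ : List A → (A → ℕ) → ℕ
  ∑ []       f = 0
  ∑ (x ∷ xs) f = f x + ∑ xs f

  syntax ∑ xs (λ x → e) = ∑[ x ∈ xs ] e

  ∑-cong : ∀ (xs : List A) → (∀ x → f x ≡ g x) → ∑ xs f ≡ ∑ xs g
  ∑-cong []       f≗g = refl
  ∑-cong (x ∷ xs) f≗g = cong₂ _+_ (f≗g x) (∑-cong xs f≗g)

  ∑-zero : All (λ x → f x ≡ 0) xs → ∑ xs f ≡ 0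
  ∑-zero []           = refl
  ∑-zero (fx≡0 ∷ f≡0) = cong₂ _+_ fx≡0 (∑-zero f≡0)

  ∑-+ : ∀ (xs : List A) f g → ∑[ x ∈ xs ] (f x + g x) ≡ ∑ xs f + ∑ xs g
  ∑-+ []       f g = refl
  ∑-+ (x ∷ xs) f g = trans (cong ((f x + g x) +_) (∑-+ xs f g)) (shuffle (f x) (g x) (∑ xs f) (∑ xs g))
    where
    shuffle : ∀ a b c d → a + b + (c + d) ≡ a + c + (b + d)
    shuffle = solve-∀

  ∑-*ˡ : ∀ (xs : List A) m f → ∑[ x ∈ xs ] (m * f x) ≡ m * ∑ xs f
  ∑-*ˡ []       m f = sym (*-zeroʳ m)
  ∑-*ˡ (x ∷ xs) m f = trans (cong (m * f x +_) (∑-*ˡ xs m f)) (sym (*-distribˡ-+ m (f x) (∑ xs f)))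

  ∑-++ : ∀ (xs ys : List A) f → ∑ (xs ++ ys) f ≡ ∑ xs f + ∑ ys f
  ∑-++ []       ys f = refl
  ∑-++ (x ∷ xs) ys f = trans (cong (f x +_) (∑-++ xs ys f)) (sym (+-assoc (f x) _ _))

  ∑-map : ∀ (h : A → B) xs (f : B → ℕ) → ∑ (map h xs) f ≡ ∑[ x ∈ xs ] f (h x)
  ∑-map h []       f = refl
  ∑-map h (x ∷ xs) f = cong (f (h x) +_) (∑-map h xs f)

  ∑-swap : ∀ (xs : List A) (ys : List B) (f : A → B → ℕ) →
           ∑[ x ∈ xs ] ∑[ y ∈ ys ] f x y ≡ ∑[ y ∈ ys ] ∑[ x ∈ xs ] f x y
  ∑-swap []       ys f = sym (∑-zero {xs = ys} (All.tabulate (λ _ → refl)))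
  ∑-swap (x ∷ xs) ys f =
    trans (cong (∑ ys (f x) +_) (∑-swap xs ys f)) (sym (∑-+ ys (f x) (λ y → ∑[ x ∈ xs ] f x y)))

  ∑-cartesianProduct : ∀ (xs : List A) (ys : List B) (f : A × B → ℕ) →
                       ∑ (cartesianProduct xs ys) f ≡ ∑[ x ∈ xs ] ∑[ y ∈ ys ] f (x , y)
  ∑-cartesianProduct []       ys f = refl
  ∑-cartesianProduct (x ∷ xs) ys f =
    trans (∑-++ (map (x ,_) ys) _ f) (cong₂ _+_ (∑-map (x ,_) ys f) (∑-cartesianProduct xs ys f))

  length-filter : ∀ (p : A → Bool) xs → length (filter (λ x → T? (p x)) xs) ≡ ∑[ x ∈ xs ] ⟦ p x ⟧
  length-filter p []       = refl
  length-filter p (x ∷ xs) with p x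
  ... | true  = cong suc (length-filter p xs)
  ... | false = length-filter p xs

  lookup-injective : ∀ {xs : List A} → Unique xs → ∀ i j → List.lookup xs i ≡ List.lookup xs j → i ≡ j
  lookup-injective (_   ∷ _)   zero    zero    _ = refl
  lookup-injective (x∉ ∷ _)   zero    (suc j) e = ⊥-elim (All.lookup x∉ (∈-lookup j) e)
  lookup-injective (x∉ ∷ _)   (suc i) zero    e = ⊥-elim (All.lookup x∉ (∈-lookup i) (sym e))
  lookup-injective (_   ∷ xs!) (suc i) (suc j) e = cong suc (lookup-injective xs! i j e)

  module _ (_≟_ : DecidableEquality A) where

    ∑-δ : ∀ {xs v} (f : A → ℕ) → Unique xs → v ∈ xs → ∑[ u ∈ xs ] (f u * 𝟙 (u ≟ v)) ≡ f v
    ∑-δ {x ∷ xs} f (x∉xs ∷ _) (here refl) rewrite dec-true (x ≟ x) refl =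
      trans (cong (f x * 1 +_) (∑-zero (All.map vanish x∉xs))) (trans (+-identityʳ _) (*-identityʳ (f x)))
      where
      vanish : ∀ {u} → x ≢ u → f u * 𝟙 (u ≟ x) ≡ 0
      vanish {u} x≢u rewrite dec-false (u ≟ x) (x≢u ∘ sym) = *-zeroʳ (f u)
    ∑-δ {x ∷ xs} {v} f (x∉xs ∷ xs!) (there v∈xs) rewrite dec-false (x ≟ v) (All.lookup x∉xs v∈xs) =
      trans (cong (_+ ∑[ u ∈ xs ] (f u * 𝟙 (u ≟ v))) (*-zeroʳ (f x))) (∑-δ f xs! v∈xs)

    ∑-δ-count : ∀ {xs v} → Unique xs → v ∈ xs → ∑[ u ∈ xs ] 𝟙 (u ≟ v) ≡ 1
    ∑-δ-count {xs} xs! v∈xs =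
      trans (∑-cong xs (λ u → sym (ℕ.*-identityˡ _))) (∑-δ (λ _ → 1) xs! v∈xs)

  -- 2 × 2 transfer matrices, indexed by bits

  Mat : Set
  Mat = Bool → Bool → ℕ

  _·_ : Mat → (Bool → ℕ) → (Bool → ℕ)
  (A · v) y = A y false * v false + A y true * v true

  _⊗_ : Mat → Mat → Mat
  (A ⊗ B) y z = A y false * B false z + A y true * B true z

  infixr 7 _⊗_
  infixr 6 _·_

  I : Mat
  I false false = 1
  I true  true  = 1
  I _     _     = 0

  Q : Mat
  Q y z = ⟦ not (y ∧ z) ⟧

  _^_ : Mat → ℕ → Mat
  A ^ zero  = I
  A ^ suc m = A ⊗ A ^ m

  trace : Mat → ℕ
  trace A = A false false + A true true

  det : Mat → ℤ
  det A = ℤ.+ A false false ℤ.* ℤ.+ A true true ℤ.- ℤ.+ A false true ℤ.* ℤ.+ A true false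

  ·-⊗ : ∀ A B v y → ((A ⊗ B) · v) y ≡ (A · B · v) y
  ·-⊗ A B v y =
    lemma (A y false) (A y true) (B false false) (B false true) (B true false) (B true true) (v false) (v true)
    where
    lemma : ∀ a₀ a₁ b₀₀ b₀₁ b₁₀ b₁₁ v₀ v₁ →
            (a₀ * b₀₀ + a₁ * b₁₀) * v₀ + (a₀ * b₀₁ + a₁ * b₁₁) * v₁
            ≡ a₀ * (b₀₀ * v₀ + b₀₁ * v₁) + a₁ * (b₁₀ * v₀ + b₁₁ * v₁)
    lemma = solve-∀

  ·-identityˡ : ∀ v y → (I · v) y ≡ v y
  ·-identityˡ v false = lemma (v false) (v true)
    where
    lemma : ∀ a b → 1 * a + 0 * b ≡ a
    lemma = solve-∀
  ·-identityˡ v true = lemma (v false) (v true)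
    where
    lemma : ∀ a b → 0 * a + 1 * b ≡ b
    lemma = solve-∀

  ⊗-identityʳ : ∀ A y z → (A ⊗ I) y z ≡ A y z
  ⊗-identityʳ A y false = lemma (A y false) (A y true)
    where
    lemma : ∀ a b → a * 1 + b * 0 ≡ a
    lemma = solve-∀
  ⊗-identityʳ A y true = lemma (A y false) (A y true)
    where
    lemma : ∀ a b → a * 0 + b * 1 ≡ b
    lemma = solve-∀

  ·-cong : ∀ A {u v : Bool → ℕ} → (∀ x → u x ≡ v x) → ∀ y → (A · u) y ≡ (A · v) y
  ·-cong A u≗v y = cong₂ _+_ (cong (A y false *_) (u≗v false)) (cong (A y true *_) (u≗v true))

  ⊗-assoc : ∀ A B C y z → ((A ⊗ B) ⊗ C) y z ≡ (A ⊗ B ⊗ C) y z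
  ⊗-assoc A B C y z = ·-⊗ A B (λ x → C x z) y

  Q-Cayley-Hamilton : ∀ A y z → (Q ⊗ Q ⊗ A) y z ≡ (Q ⊗ A) y z + A y z
  Q-Cayley-Hamilton A false z = lemma (A false z) (A true z)
    where
    lemma : ∀ a b → 1 * (1 * a + 1 * b) + 1 * (1 * a + 0 * b) ≡ 1 * a + 1 * b + a
    lemma = solve-∀
  Q-Cayley-Hamilton A true z = lemma (A false z) (A true z)
    where
    lemma : ∀ a b → 1 * (1 * a + 1 * b) + 0 * (1 * a + 0 * b) ≡ 1 * a + 0 * b + b
    lemma = solve-∀

  trace-Q^ : ∀ m → trace (Q ^ m) ≡ lucas m
  trace-Q^ zero          = refl
  trace-Q^ (suc zero)    = refl
  trace-Q^ (suc (suc m)) = begin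
    trace (Q ⊗ Q ⊗ Q ^ m)
      ≡⟨ cong₂ _+_ (Q-Cayley-Hamilton (Q ^ m) false false) (Q-Cayley-Hamilton (Q ^ m) true true) ⟩
    (Q ⊗ Q ^ m) false false + (Q ^ m) false false + ((Q ⊗ Q ^ m) true true + (Q ^ m) true true)
      ≡⟨ shuffle ((Q ⊗ Q ^ m) false false) ((Q ^ m) false false) ((Q ⊗ Q ^ m) true true) ((Q ^ m) true true) ⟩
    trace (Q ^ suc m) + trace (Q ^ m)
      ≡⟨ cong₂ _+_ (trace-Q^ (suc m)) (trace-Q^ m) ⟩
    lucas (suc (suc m)) ∎
    where
    open ≡-Reasoning
    shuffle : ∀ a b c d → a + b + (c + d) ≡ a + c + (b + d)
    shuffle = solve-∀

  pos-⊗ : ∀ A B y z →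
          ℤ.+ (A ⊗ B) y z ≡ ℤ.+ A y false ℤ.* ℤ.+ B false z ℤ.+ ℤ.+ A y true ℤ.* ℤ.+ B true z
  pos-⊗ A B y z = trans (pos-+ (A y false * B false z) (A y true * B true z))
                        (cong₂ ℤ._+_ (pos-* (A y false) (B false z)) (pos-* (A y true) (B true z)))

  det-cong : ∀ {A a₀₀ a₀₁ a₁₀ a₁₁} →
             ℤ.+ A false false ≡ a₀₀ → ℤ.+ A false true ≡ a₀₁ →
             ℤ.+ A true false ≡ a₁₀ → ℤ.+ A true true ≡ a₁₁ →
             det A ≡ a₀₀ ℤ.* a₁₁ ℤ.- a₀₁ ℤ.* a₁₀
  det-cong refl refl refl refl = refl

  det-⊗ : ∀ A B → det (A ⊗ B) ≡ det A ℤ.* det B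
  det-⊗ A B =
    trans (det-cong {A ⊗ B} (pos-⊗ A B false false) (pos-⊗ A B false true)
                            (pos-⊗ A B true false) (pos-⊗ A B true true))
          (lemma (ℤ.+ A false false) (ℤ.+ A false true) (ℤ.+ A true false) (ℤ.+ A true true)
                 (ℤ.+ B false false) (ℤ.+ B false true) (ℤ.+ B true false) (ℤ.+ B true true))
    where
    lemma : ∀ a₀₀ a₀₁ a₁₀ a₁₁ b₀₀ b₀₁ b₁₀ b₁₁ →
      (a₀₀ ℤ.* b₀₀ ℤ.+ a₀₁ ℤ.* b₁₀) ℤ.* (a₁₀ ℤ.* b₀₁ ℤ.+ a₁₁ ℤ.* b₁₁)
        ℤ.- (a₀₀ ℤ.* b₀₁ ℤ.+ a₀₁ ℤ.* b₁₁) ℤ.* (a₁₀ ℤ.* b₀₀ ℤ.+ a₁₁ ℤ.* b₁₀)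
      ≡ (a₀₀ ℤ.* a₁₁ ℤ.- a₀₁ ℤ.* a₁₀) ℤ.* (b₀₀ ℤ.* b₁₁ ℤ.- b₀₁ ℤ.* b₁₀)
    lemma = ℤ-solve-∀

  det-Q^ : ∀ m → det (Q ^ m) ≡ sgn m
  det-Q^ zero    = refl
  det-Q^ (suc m) = trans (det-⊗ Q (Q ^ m)) (cong (ℤ.-1ℤ ℤ.*_) (det-Q^ m))

  trace-⊗-self : ∀ A → ℤ.+ trace (A ⊗ A) ≡ ℤ.+ trace A ℤ.* ℤ.+ trace A ℤ.- ℤ.+ 2 ℤ.* det A
  trace-⊗-self A = begin
    ℤ.+ trace (A ⊗ A)
      ≡⟨ trans (pos-+ ((A ⊗ A) false false) ((A ⊗ A) true true))
               (cong₂ ℤ._+_ (pos-⊗ A A false false) (pos-⊗ A A true true)) ⟩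
    a₀₀ ℤ.* a₀₀ ℤ.+ a₀₁ ℤ.* a₁₀ ℤ.+ (a₁₀ ℤ.* a₀₁ ℤ.+ a₁₁ ℤ.* a₁₁)
      ≡⟨ lemma a₀₀ a₀₁ a₁₀ a₁₁ ⟩
    (a₀₀ ℤ.+ a₁₁) ℤ.* (a₀₀ ℤ.+ a₁₁) ℤ.- ℤ.+ 2 ℤ.* det A
      ≡⟨ cong (λ t → t ℤ.* t ℤ.- ℤ.+ 2 ℤ.* det A) (pos-+ (A false false) (A true true)) ⟨
    ℤ.+ trace A ℤ.* ℤ.+ trace A ℤ.- ℤ.+ 2 ℤ.* det A ∎
    where
    open ≡-Reasoning
    a₀₀ = ℤ.+ A false false
    a₀₁ = ℤ.+ A false true
    a₁₀ = ℤ.+ A true false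
    a₁₁ = ℤ.+ A true true
    lemma : ∀ a₀₀ a₀₁ a₁₀ a₁₁ →
      a₀₀ ℤ.* a₀₀ ℤ.+ a₀₁ ℤ.* a₁₀ ℤ.+ (a₁₀ ℤ.* a₀₁ ℤ.+ a₁₁ ℤ.* a₁₁)
      ≡ (a₀₀ ℤ.+ a₁₁) ℤ.* (a₀₀ ℤ.+ a₁₁) ℤ.- ℤ.+ 2 ℤ.* (a₀₀ ℤ.* a₁₁ ℤ.- a₀₁ ℤ.* a₁₀)
    lemma = ℤ-solve-∀

  trace-⊗⁴ : ∀ A →
    ℤ.+ trace (A ⊗ A ⊗ A ⊗ A)
    ≡ ℤ.+ trace (A ⊗ A) ℤ.* ℤ.+ trace (A ⊗ A) ℤ.- ℤ.+ 2 ℤ.* (det A ℤ.* det A)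
  trace-⊗⁴ A = begin
    ℤ.+ trace (A ⊗ A ⊗ A ⊗ A)
      ≡⟨ cong ℤ.+_ (cong₂ _+_ (⊗-assoc A A (A ⊗ A) false false) (⊗-assoc A A (A ⊗ A) true true)) ⟨
    ℤ.+ trace ((A ⊗ A) ⊗ (A ⊗ A))
      ≡⟨ trace-⊗-self (A ⊗ A) ⟩
    ℤ.+ trace (A ⊗ A) ℤ.* ℤ.+ trace (A ⊗ A) ℤ.- ℤ.+ 2 ℤ.* det (A ⊗ A)
      ≡⟨ cong (λ d → ℤ.+ trace (A ⊗ A) ℤ.* ℤ.+ trace (A ⊗ A) ℤ.- ℤ.+ 2 ℤ.* d) (det-⊗ A A) ⟩
    ℤ.+ trace (A ⊗ A) ℤ.* ℤ.+ trace (A ⊗ A) ℤ.- ℤ.+ 2 ℤ.* (det A ℤ.* det A) ∎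
    where open ≡-Reasoning

  -- Words without two adjacent ones

  words : ∀ m → List (Vec Bool m)
  words zero    = [] ∷ []
  words (suc m) = map (false ∷_) (words m) ++ map (true ∷_) (words m)

  ∈-words : ∀ (v : Vec Bool m) → v ∈ words m
  ∈-words []          = here refl
  ∈-words (false ∷ v) = ∈-++⁺ˡ (∈-map⁺ (false ∷_) (∈-words v))
  ∈-words (true ∷ v)  = ∈-++⁺ʳ (map (false ∷_) (words _)) (∈-map⁺ (true ∷_) (∈-words v))

  words-unique : ∀ m → Unique (words m)
  words-unique zero    = [] ∷ []
  words-unique (suc m) =
    Unique.++⁺ (Unique.map⁺ Vec.∷-injectiveʳ (words-unique m)) (Unique.map⁺ Vec.∷-injectiveʳ (words-unique m))
               disjoint
    where
    disjoint : ∀ {v} → ¬ (v ∈ map (false ∷_) (words m) × v ∈ map (true ∷_) (words m))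
    disjoint (v∈₀ , v∈₁) with ∈-map⁻ (false ∷_) v∈₀ | ∈-map⁻ (true ∷_) v∈₁
    ... | _ , _ , refl | _ , _ , ()

  ∑-words-suc : ∀ m (f : Vec Bool (suc m) → ℕ) →
                ∑ (words (suc m)) f ≡ ∑[ w ∈ words m ] f (false ∷ w) + ∑[ w ∈ words m ] f (true ∷ w)
  ∑-words-suc m f = trans (∑-++ (map (false ∷_) (words m)) _ f)
                          (cong₂ _+_ (∑-map (false ∷_) (words m) f) (∑-map (true ∷_) (words m) f))

  sparseAfter : Bool → Vec Bool m → Bool
  sparseAfter y []      = true
  sparseAfter y (b ∷ v) = not (y ∧ b) ∧ sparseAfter b v

  lastOf : Bool → Vec Bool m → Bool
  lastOf y []      = y
  lastOf y (b ∷ v) = lastOf b v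

  sparseAfter-sound : ∀ y (v : Vec Bool m) → sparseAfter y v ≡ true →
                      ∀ i → lookup (y ∷ v) (inject₁ i) ∧ lookup (y ∷ v) (suc i) ≡ false
  sparseAfter-sound y (b ∷ v) h zero    = not-injective (∧-conicalˡ _ _ h)
  sparseAfter-sound y (b ∷ v) h (suc i) = sparseAfter-sound b v (∧-conicalʳ _ _ h) i

  sparseAfter-complete : ∀ y (v : Vec Bool m) →
                         (∀ i → lookup (y ∷ v) (inject₁ i) ∧ lookup (y ∷ v) (suc i) ≡ false) →
                         sparseAfter y v ≡ true
  sparseAfter-complete y []      h = refl
  sparseAfter-complete y (b ∷ v) h rewrite h zero = sparseAfter-complete b v (h ∘ suc)

  lookup-ext : ∀ (u v : Vec A m) → (∀ i → lookup u i ≡ lookup v i) → u ≡ v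
  lookup-ext u v h = trans (sym (Vec.tabulate∘lookup u)) (trans (Vec.tabulate-cong h) (Vec.tabulate∘lookup v))

  lookup-fromℕ : ∀ (v : Vec Bool (suc m)) → lookup v (fromℕ m) ≡ last v
  lookup-fromℕ (b ∷ [])    = refl
  lookup-fromℕ (b ∷ c ∷ v) = lookup-fromℕ (c ∷ v)

  ∑-sparseAfter : ∀ m y (G : Bool → ℕ) →
                  ∑[ v ∈ words m ] (⟦ sparseAfter y v ⟧ * G (lastOf y v)) ≡ (Q ^ m · G) y
  ∑-sparseAfter zero false G = refl
  ∑-sparseAfter zero true  G = +-identityʳ (G true + 0)
  ∑-sparseAfter (suc m) y G = begin
    ∑[ v ∈ words (suc m) ] (⟦ sparseAfter y v ⟧ * G (lastOf y v))
      ≡⟨ ∑-words-suc m _ ⟩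
    ∑[ w ∈ words m ] (⟦ not (y ∧ false) ∧ sparseAfter false w ⟧ * G (lastOf false w))
      + ∑[ w ∈ words m ] (⟦ not (y ∧ true) ∧ sparseAfter true w ⟧ * G (lastOf true w))
      ≡⟨ cong₂ _+_ (first-letter false) (first-letter true) ⟩
    (Q · Q ^ m · G) y
      ≡⟨ ·-⊗ Q (Q ^ m) G y ⟨
    (Q ^ suc m · G) y ∎
    where
    open ≡-Reasoning
    first-letter : ∀ b →
      ∑[ w ∈ words m ] (⟦ not (y ∧ b) ∧ sparseAfter b w ⟧ * G (lastOf b w)) ≡ Q y b * (Q ^ m · G) b
    first-letter b = begin
      ∑[ w ∈ words m ] (⟦ not (y ∧ b) ∧ sparseAfter b w ⟧ * G (lastOf b w))
        ≡⟨ ∑-cong (words m) (λ w → trans (cong (_* G (lastOf b w)) (⟦∧⟧ (not (y ∧ b)) (sparseAfter b w)))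
                                         (*-assoc (Q y b) _ _)) ⟩
      ∑[ w ∈ words m ] (Q y b * (⟦ sparseAfter b w ⟧ * G (lastOf b w)))
        ≡⟨ ∑-*ˡ (words m) (Q y b) _ ⟩
      Q y b * ∑[ w ∈ words m ] (⟦ sparseAfter b w ⟧ * G (lastOf b w))
        ≡⟨ cong (Q y b *_) (∑-sparseAfter m b G) ⟩
      Q y b * (Q ^ m · G) b ∎

  last≡lastOf : ∀ y (v : Vec Bool (suc m)) → last v ≡ lastOf y v
  last≡lastOf y (b ∷ [])    = refl
  last≡lastOf y (b ∷ c ∷ w) = last≡lastOf b (c ∷ w)

  -- Necklaces: cyclic words cut into four blocks

  module Necklaces (k : ℕ) where

    Block : Set
    Block = Vec Bool (suc k)

    Necklace : Set
    Necklace = Block × Block × Block × Block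

    blocks : List Block
    blocks = words (suc k)

    Qₖ : Mat
    Qₖ = Q ^ suc k

    canFollow : Block → Bool → ℕ
    canFollow a x = ⟦ sparseAfter x a ⟧

    necklaces : List Necklace
    necklaces = cartesianProduct blocks (cartesianProduct blocks (cartesianProduct blocks blocks))

    ∑-necklaces : ∀ (f : Necklace → ℕ) →
      ∑ necklaces f ≡ ∑[ a ∈ blocks ] ∑[ b ∈ blocks ] ∑[ c ∈ blocks ] ∑[ d ∈ blocks ] f (a , b , c , d)
    ∑-necklaces f =
      trans (∑-cartesianProduct blocks _ f) (∑-cong blocks (λ a →
      trans (∑-cartesianProduct blocks _ _) (∑-cong blocks (λ b → ∑-cartesianProduct blocks blocks _))))

    _≟ᵥ_ : DecidableEquality Block
    _≟ᵥ_ = Vec.≡-dec _≟ᵇ_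

    _≟ₙ_ : DecidableEquality Necklace
    _≟ₙ_ = Product.≡-dec _≟ᵥ_ (Product.≡-dec _≟ᵥ_ (Product.≡-dec _≟ᵥ_ _≟ᵥ_))

    ρ : Necklace → Necklace
    ρ (a , b , c , d) = (d , a , b , c)

    valid : Necklace → Bool
    valid (a , b , c , d) =
      sparseAfter (last a) b ∧ (sparseAfter (last b) c ∧ (sparseAfter (last c) d ∧ sparseAfter (last d) a))

    valid-ρ : ∀ (x : Necklace) → valid (ρ x) ≡ valid x
    valid-ρ (a , b , c , d) =
      rotate (sparseAfter (last a) b) (sparseAfter (last b) c) (sparseAfter (last c) d) (sparseAfter (last d) a)
      where
      rotate : ∀ p q r s → s ∧ (p ∧ (q ∧ r)) ≡ p ∧ (q ∧ (r ∧ s))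
      rotate p q r s = trans (∧-comm s _) (trans (∧-assoc p _ s) (cong (p ∧_) (∧-assoc q r s)))

    valid-iter : ∀ j (x : Necklace) → valid (iter j ρ x) ≡ valid x
    valid-iter zero    x = refl
    valid-iter (suc j) x = trans (valid-ρ (iter j ρ x)) (valid-iter j x)

    ∈-necklaces : ∀ (x : Necklace) → x ∈ necklaces
    ∈-necklaces (a , b , c , d) =
      ∈-cartesianProduct⁺ (∈-words a)
        (∈-cartesianProduct⁺ (∈-words b) (∈-cartesianProduct⁺ (∈-words c) (∈-words d)))

    necklaces-unique : Unique necklaces
    necklaces-unique =
      Unique.cartesianProduct⁺ blocks! (Unique.cartesianProduct⁺ blocks! (Unique.cartesianProduct⁺ blocks! blocks!))
      where blocks! = words-unique (suc k)

    ∑-transfer : ∀ y (F : Bool → ℕ) → ∑[ v ∈ blocks ] (canFollow v y * F (last v)) ≡ (Qₖ · F) y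
    ∑-transfer y F =
      trans (∑-cong blocks (λ v → cong (λ z → canFollow v y * F z) (last≡lastOf y v)))
            (∑-sparseAfter (suc k) y F)

    ∑-transferˡ : ∀ n y (F : Bool → ℕ) →
                  ∑[ v ∈ blocks ] (n * (canFollow v y * F (last v))) ≡ n * (Qₖ · F) y
    ∑-transferˡ n y F = trans (∑-*ˡ blocks n _) (cong (n *_) (∑-transfer y F))

    ∑-trace : ∀ (A : Mat) → ∑[ a ∈ blocks ] (A · canFollow a) (last a) ≡ trace (Qₖ ⊗ A)
    ∑-trace A = trans (∑-+ blocks _ _) (cong₂ _+_ (diagonal false) (diagonal true))
      where
      diagonal : ∀ z → ∑[ a ∈ blocks ] (A (last a) z * canFollow a z) ≡ (Qₖ ⊗ A) z z
      diagonal z = trans (∑-cong blocks (λ a → *-comm (A (last a) z) _)) (∑-transfer z (λ x → A x z))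

    ⟦valid⟧ : ∀ (a b c d : Block) →
      ⟦ valid (a , b , c , d) ⟧
      ≡ canFollow b (last a) * (canFollow c (last b) * (canFollow d (last c) * canFollow a (last d)))
    ⟦valid⟧ a b c d =
      trans (⟦∧⟧ (sparseAfter (last a) b) _) (cong (canFollow b (last a) *_)
      (trans (⟦∧⟧ (sparseAfter (last b) c) _) (cong (canFollow c (last b) *_)
      (⟦∧⟧ (sparseAfter (last c) d) _))))

    count-valid : ∑[ x ∈ necklaces ] ⟦ valid x ⟧ ≡ trace (Qₖ ⊗ Qₖ ⊗ Qₖ ⊗ Qₖ)
    count-valid = begin
      ∑[ x ∈ necklaces ] ⟦ valid x ⟧
        ≡⟨ ∑-necklaces _ ⟩
      ∑[ a ∈ blocks ] ∑[ b ∈ blocks ] ∑[ c ∈ blocks ] ∑[ d ∈ blocks ] ⟦ valid (a , b , c , d) ⟧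
        ≡⟨ ∑-cong blocks (λ a →
             trans (∑-cong blocks (λ b → trans (∑-cong blocks (sum-d a b)) (sum-c a b))) (sum-b a)) ⟩
      ∑[ a ∈ blocks ] (Qₖ · Qₖ · Qₖ · canFollow a) (last a)
        ≡⟨ ∑-cong blocks (λ a → trans (·-⊗ Qₖ (Qₖ ⊗ Qₖ) (canFollow a) (last a))
                                      (·-cong Qₖ (·-⊗ Qₖ Qₖ (canFollow a)) (last a))) ⟨
      ∑[ a ∈ blocks ] ((Qₖ ⊗ Qₖ ⊗ Qₖ) · canFollow a) (last a)
        ≡⟨ ∑-trace (Qₖ ⊗ Qₖ ⊗ Qₖ) ⟩
      trace (Qₖ ⊗ Qₖ ⊗ Qₖ ⊗ Qₖ) ∎
      where
      open ≡-Reasoning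
      sum-d : ∀ a b c → ∑[ d ∈ blocks ] ⟦ valid (a , b , c , d) ⟧
                        ≡ canFollow b (last a) * (canFollow c (last b) * (Qₖ · canFollow a) (last c))
      sum-d a b c =
        trans (∑-cong blocks (⟦valid⟧ a b c))
       (trans (∑-*ˡ blocks (canFollow b (last a)) _)
              (cong (canFollow b (last a) *_) (∑-transferˡ (canFollow c (last b)) (last c) (canFollow a))))
      sum-c : ∀ a b → ∑[ c ∈ blocks ] (canFollow b (last a) * (canFollow c (last b) * (Qₖ · canFollow a) (last c)))
                      ≡ canFollow b (last a) * (Qₖ · Qₖ · canFollow a) (last b)
      sum-c a b = ∑-transferˡ (canFollow b (last a)) (last b) (Qₖ · canFollow a)
      sum-b : ∀ a → ∑[ b ∈ blocks ] (canFollow b (last a) * (Qₖ · Qₖ · canFollow a) (last b))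
                    ≡ (Qₖ · Qₖ · Qₖ · canFollow a) (last a)
      sum-b a = ∑-transfer (last a) (Qₖ · Qₖ · canFollow a)

    ρ²-fixed⇔ : ∀ {a b c d : Block} → ρ (ρ (a , b , c , d)) ≡ (a , b , c , d) ⇔ (c ≡ a × d ≡ b)
    ρ²-fixed⇔ = mk⇔ (λ { refl → refl , refl }) (λ { (refl , refl) → refl })

    ρ-fixed⇔ : ∀ {a b c d : Block} → ρ (a , b , c , d) ≡ (a , b , c , d) ⇔ (b ≡ a × c ≡ a × d ≡ a)
    ρ-fixed⇔ = mk⇔ (λ { refl → refl , refl , refl }) (λ { (refl , refl , refl) → refl })

    ∑-δ-blocks : ∀ (f : Block → ℕ) v → ∑[ u ∈ blocks ] (f u * 𝟙 (u ≟ᵥ v)) ≡ f v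
    ∑-δ-blocks f v = ∑-δ _≟ᵥ_ f (words-unique (suc k)) (∈-words v)

    ∑-ρ²-fixed : ∀ (f : Necklace → ℕ) →
      ∑[ x ∈ necklaces ] (f x * 𝟙 (ρ (ρ x) ≟ₙ x)) ≡ ∑[ a ∈ blocks ] ∑[ b ∈ blocks ] f (a , b , a , b)
    ∑-ρ²-fixed f = trans (∑-necklaces _) (∑-cong blocks (λ a → ∑-cong blocks (λ b →
      begin
        ∑[ c ∈ blocks ] ∑[ d ∈ blocks ] (f (a , b , c , d) * 𝟙 (ρ (ρ (a , b , c , d)) ≟ₙ (a , b , c , d)))
          ≡⟨ ∑-cong blocks (λ c → ∑-cong blocks (λ d → fixed a b c d)) ⟩
        ∑[ c ∈ blocks ] ∑[ d ∈ blocks ] (f (a , b , c , d) * 𝟙 (c ≟ᵥ a) * 𝟙 (d ≟ᵥ b))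
          ≡⟨ ∑-cong blocks (λ c → ∑-δ-blocks (λ d → f (a , b , c , d) * 𝟙 (c ≟ᵥ a)) b) ⟩
        ∑[ c ∈ blocks ] (f (a , b , c , b) * 𝟙 (c ≟ᵥ a))
          ≡⟨ ∑-δ-blocks (λ c → f (a , b , c , b)) a ⟩
        f (a , b , a , b) ∎)))
      where
      open ≡-Reasoning
      fixed : ∀ a b c d → f (a , b , c , d) * 𝟙 (ρ (ρ (a , b , c , d)) ≟ₙ (a , b , c , d))
                        ≡ f (a , b , c , d) * 𝟙 (c ≟ᵥ a) * 𝟙 (d ≟ᵥ b)
      fixed a b c d =
        trans (cong (f (a , b , c , d) *_)
                    (trans (𝟙-⇔ (ρ (ρ (a , b , c , d)) ≟ₙ (a , b , c , d)) ((c ≟ᵥ a) ×-dec (d ≟ᵥ b)) ρ²-fixed⇔)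
                           (𝟙-× (c ≟ᵥ a) (d ≟ᵥ b))))
              (sym (*-assoc (f (a , b , c , d)) _ _))

    ∑-ρ-fixed : ∀ (f : Necklace → ℕ) →
      ∑[ x ∈ necklaces ] (f x * 𝟙 (ρ x ≟ₙ x)) ≡ ∑[ a ∈ blocks ] f (a , a , a , a)
    ∑-ρ-fixed f = trans (∑-necklaces _) (∑-cong blocks (λ a →
      begin
        ∑[ b ∈ blocks ] ∑[ c ∈ blocks ] ∑[ d ∈ blocks ]
          (f (a , b , c , d) * 𝟙 (ρ (a , b , c , d) ≟ₙ (a , b , c , d)))
          ≡⟨ ∑-cong blocks (λ b → ∑-cong blocks (λ c → ∑-cong blocks (λ d → fixed a b c d))) ⟩
        ∑[ b ∈ blocks ] ∑[ c ∈ blocks ] ∑[ d ∈ blocks ]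
          (f (a , b , c , d) * 𝟙 (b ≟ᵥ a) * 𝟙 (c ≟ᵥ a) * 𝟙 (d ≟ᵥ a))
          ≡⟨ ∑-cong blocks (λ b → ∑-cong blocks (λ c →
               ∑-δ-blocks (λ d → f (a , b , c , d) * 𝟙 (b ≟ᵥ a) * 𝟙 (c ≟ᵥ a)) a)) ⟩
        ∑[ b ∈ blocks ] ∑[ c ∈ blocks ] (f (a , b , c , a) * 𝟙 (b ≟ᵥ a) * 𝟙 (c ≟ᵥ a))
          ≡⟨ ∑-cong blocks (λ b → ∑-δ-blocks (λ c → f (a , b , c , a) * 𝟙 (b ≟ᵥ a)) a) ⟩
        ∑[ b ∈ blocks ] (f (a , b , a , a) * 𝟙 (b ≟ᵥ a))
          ≡⟨ ∑-δ-blocks (λ b → f (a , b , a , a)) a ⟩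
        f (a , a , a , a) ∎))
      where
      open ≡-Reasoning
      reassociate : ∀ p q r s → p * (q * (r * s)) ≡ p * q * r * s
      reassociate = solve-∀
      fixed : ∀ a b c d → f (a , b , c , d) * 𝟙 (ρ (a , b , c , d) ≟ₙ (a , b , c , d))
                        ≡ f (a , b , c , d) * 𝟙 (b ≟ᵥ a) * 𝟙 (c ≟ᵥ a) * 𝟙 (d ≟ᵥ a)
      fixed a b c d = trans (cong (f (a , b , c , d) *_) (begin
          𝟙 (ρ (a , b , c , d) ≟ₙ (a , b , c , d))
            ≡⟨ 𝟙-⇔ (ρ (a , b , c , d) ≟ₙ (a , b , c , d)) ((b ≟ᵥ a) ×-dec (c ≟ᵥ a) ×-dec (d ≟ᵥ a)) ρ-fixed⇔ ⟩
          𝟙 ((b ≟ᵥ a) ×-dec (c ≟ᵥ a) ×-dec (d ≟ᵥ a))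
            ≡⟨ 𝟙-× (b ≟ᵥ a) ((c ≟ᵥ a) ×-dec (d ≟ᵥ a)) ⟩
          𝟙 (b ≟ᵥ a) * 𝟙 ((c ≟ᵥ a) ×-dec (d ≟ᵥ a))
            ≡⟨ cong (𝟙 (b ≟ᵥ a) *_) (𝟙-× (c ≟ᵥ a) (d ≟ᵥ a)) ⟩
          𝟙 (b ≟ᵥ a) * (𝟙 (c ≟ᵥ a) * 𝟙 (d ≟ᵥ a)) ∎))
        (reassociate (f (a , b , c , d)) _ _ _)

    count-valid-ρ²-fixed : ∑[ x ∈ necklaces ] (⟦ valid x ⟧ * 𝟙 (ρ (ρ x) ≟ₙ x)) ≡ trace (Qₖ ⊗ Qₖ)
    count-valid-ρ²-fixed = begin
      ∑[ x ∈ necklaces ] (⟦ valid x ⟧ * 𝟙 (ρ (ρ x) ≟ₙ x))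
        ≡⟨ ∑-ρ²-fixed (λ x → ⟦ valid x ⟧) ⟩
      ∑[ a ∈ blocks ] ∑[ b ∈ blocks ] ⟦ valid (a , b , a , b) ⟧
        ≡⟨ ∑-cong blocks (λ a → trans (∑-cong blocks (valid-period-2 a)) (∑-transfer (last a) (canFollow a))) ⟩
      ∑[ a ∈ blocks ] (Qₖ · canFollow a) (last a)
        ≡⟨ ∑-trace Qₖ ⟩
      trace (Qₖ ⊗ Qₖ) ∎
      where
      open ≡-Reasoning
      idempotent : ∀ p q → p ∧ (q ∧ (p ∧ q)) ≡ p ∧ q
      idempotent false q     = refl
      idempotent true  false = refl
      idempotent true  true  = refl
      valid-period-2 : ∀ a b → ⟦ valid (a , b , a , b) ⟧ ≡ canFollow b (last a) * canFollow a (last b)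
      valid-period-2 a b = trans (cong ⟦_⟧ (idempotent (sparseAfter (last a) b) _)) (⟦∧⟧ (sparseAfter (last a) b) _)

    count-valid-ρ-fixed : ∑[ x ∈ necklaces ] (⟦ valid x ⟧ * 𝟙 (ρ x ≟ₙ x)) ≡ trace Qₖ
    count-valid-ρ-fixed = begin
      ∑[ x ∈ necklaces ] (⟦ valid x ⟧ * 𝟙 (ρ x ≟ₙ x))
        ≡⟨ ∑-ρ-fixed (λ x → ⟦ valid x ⟧) ⟩
      ∑[ a ∈ blocks ] ⟦ valid (a , a , a , a) ⟧
        ≡⟨ ∑-cong blocks (λ a → trans (cong ⟦_⟧ (idempotent (sparseAfter (last a) a)))
                                      (sym (·-identityˡ (canFollow a) (last a)))) ⟩
      ∑[ a ∈ blocks ] (I · canFollow a) (last a)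
        ≡⟨ ∑-trace I ⟩
      trace (Qₖ ⊗ I)
        ≡⟨ cong₂ _+_ (⊗-identityʳ Qₖ false false) (⊗-identityʳ Qₖ true true) ⟩
      trace Qₖ ∎
      where
      open ≡-Reasoning
      idempotent : ∀ p → p ∧ (p ∧ (p ∧ p)) ≡ p
      idempotent false = refl
      idempotent true  = refl

  -- Burnside's lemma for a cyclic group of order four, with canonical representatives

  module C₄-Burnside {X : Set} (_≟_ : DecidableEquality X) (elements : List X)
                     (complete : ∀ x → x ∈ elements) (unique : Unique elements)
                     (r : X → X) (r⁴ : ∀ x → r (r (r (r x))) ≡ x) where

    r-injective : ∀ {x y} → r x ≡ r y → x ≡ y
    r-injective {x} {y} e = trans (sym (r⁴ x)) (trans (cong (λ z → r (r (r z))) e) (r⁴ y))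

    code : X → ℕ
    code x = toℕ (Any.index (complete x))

    code-injective : ∀ {x y} → code x ≡ code y → x ≡ y
    code-injective {x} {y} e =
      trans (lookup-index (complete x))
            (trans (cong (List.lookup elements) (Fin.toℕ-injective e)) (sym (lookup-index (complete y))))

    orbit : X → List X
    orbit x = x ∷ r x ∷ r (r x) ∷ r (r (r x)) ∷ []

    orbitMin : X → ℕ
    orbitMin x = code x ⊓ (code (r x) ⊓ (code (r (r x)) ⊓ code (r (r (r x)))))

    canonical : X → Bool
    canonical x = does (code x ℕ.≟ orbitMin x)

    orbitMin-r : ∀ x → orbitMin (r x) ≡ orbitMin x
    orbitMin-r x = begin
      c₁ ⊓ (c₂ ⊓ (c₃ ⊓ code (r (r (r (r x))))))  ≡⟨ cong (λ y → c₁ ⊓ (c₂ ⊓ (c₃ ⊓ code y))) (r⁴ x) ⟩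
      c₁ ⊓ (c₂ ⊓ (c₃ ⊓ c₀))                      ≡⟨ cong (c₁ ⊓_) (ℕ.⊓-assoc c₂ c₃ c₀) ⟨
      c₁ ⊓ ((c₂ ⊓ c₃) ⊓ c₀)                      ≡⟨ ℕ.⊓-assoc c₁ _ c₀ ⟨
      (c₁ ⊓ (c₂ ⊓ c₃)) ⊓ c₀                      ≡⟨ ℕ.⊓-comm _ c₀ ⟩
      c₀ ⊓ (c₁ ⊓ (c₂ ⊓ c₃))                      ∎
      where
      open ≡-Reasoning
      c₀ = code x
      c₁ = code (r x)
      c₂ = code (r (r x))
      c₃ = code (r (r (r x)))

    orbitMin-iter : ∀ j x → orbitMin (iter j r x) ≡ orbitMin x
    orbitMin-iter zero    x = refl
    orbitMin-iter (suc j) x = trans (orbitMin-r (iter j r x)) (orbitMin-iter j x)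

    orbitMin-attained : ∀ x → orbitMin x ∈ map code (orbit x)
    orbitMin-attained x with ℕ.⊓-sel (code x) (code (r x) ⊓ (code (r (r x)) ⊓ code (r (r (r x)))))
    ... | inj₁ e = here e
    ... | inj₂ e with ℕ.⊓-sel (code (r x)) (code (r (r x)) ⊓ code (r (r (r x))))
    ...   | inj₁ e′ = there (here (trans e e′))
    ...   | inj₂ e′ with ℕ.⊓-sel (code (r (r x))) (code (r (r (r x))))
    ...     | inj₁ e″ = there (there (here (trans e (trans e′ e″))))
    ...     | inj₂ e″ = there (there (there (here (trans e (trans e′ e″)))))

    canonical-iter : ∀ j x → code (iter j r x) ≡ orbitMin x → T (canonical (iter j r x))
    canonical-iter j x e = subst (λ μ → T (code (iter j r x) ≡ᵇ μ)) (sym (orbitMin-iter j x)) (ℕ.≡⇒≡ᵇ _ _ e)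

    canonical-exists : ∀ x → ∃[ j ] T (canonical (iter (toℕ {4} j) r x))
    canonical-exists x with orbitMin-attained x
    ... | here e                      = 0F , canonical-iter 0 x (sym e)
    ... | there (here e)              = 1F , canonical-iter 1 x (sym e)
    ... | there (there (here e))      = 2F , canonical-iter 2 x (sym e)
    ... | there (there (there (here e))) = 3F , canonical-iter 3 x (sym e)

    canonical-unique : ∀ j x → T (canonical x) → T (canonical (iter j r x)) → iter j r x ≡ x
    canonical-unique j x can-x can-rʲx = code-injective (begin
      code (iter j r x)      ≡⟨ ℕ.≡ᵇ⇒≡ _ _ can-rʲx ⟩
      orbitMin (iter j r x)  ≡⟨ orbitMin-iter j x ⟩
      orbitMin x             ≡⟨ ℕ.≡ᵇ⇒≡ _ _ can-x ⟨
      code x                 ∎)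
      where open ≡-Reasoning

    canonical-orbit : ∀ x →
      ∑[ y ∈ orbit x ] ⟦ canonical y ⟧ ≡ ∑[ c ∈ map code (orbit x) ] 𝟙 (c ℕ.≟ orbitMin x)
    canonical-orbit x = cong₂ _+_ (term 0) (cong₂ _+_ (term 1) (cong₂ _+_ (term 2) (cong₂ _+_ (term 3) refl)))
      where
      term : ∀ j → ⟦ canonical (iter j r x) ⟧ ≡ 𝟙 (code (iter j r x) ℕ.≟ orbitMin x)
      term j = cong (λ μ → 𝟙 (code (iter j r x) ℕ.≟ μ)) (orbitMin-iter j x)

    ∑-orbit-fixed : ∀ x → r x ≡ x → ∑[ y ∈ orbit x ] ⟦ canonical y ⟧ ≡ 4
    ∑-orbit-fixed x rx≡x =
      trans (canonical-orbit x)
     (trans (cong (λ L → ∑[ c ∈ map code L ] 𝟙 (c ℕ.≟ orbitMin x)) orbit≡)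
            (cong (λ b → ⟦ b ⟧ + (⟦ b ⟧ + (⟦ b ⟧ + (⟦ b ⟧ + 0)))) (dec-true (code x ℕ.≟ orbitMin x) (sym μ≡c₀))))
      where
      r²x≡x = trans (cong r rx≡x) rx≡x
      orbit≡ : orbit x ≡ x ∷ x ∷ x ∷ x ∷ []
      orbit≡ = cong₂ (λ a b → x ∷ a ∷ b) rx≡x (cong₂ (λ a b → a ∷ b ∷ []) r²x≡x (trans (cong r r²x≡x) rx≡x))
      μ≡c₀ : orbitMin x ≡ code x
      μ≡c₀ with subst (λ L → orbitMin x ∈ map code L) orbit≡ (orbitMin-attained x)
      ... | here e                         = e
      ... | there (here e)                 = e
      ... | there (there (here e))         = e
      ... | there (there (there (here e))) = e

    ∑-orbit-period-2 : ∀ x → r x ≢ x → r (r x) ≡ x → ∑[ y ∈ orbit x ] ⟦ canonical y ⟧ ≡ 2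
    ∑-orbit-period-2 x rx≢x r²x≡x = begin
      ∑[ y ∈ orbit x ] ⟦ canonical y ⟧
        ≡⟨ canonical-orbit x ⟩
      ∑[ c ∈ map code (orbit x) ] 𝟙 (c ℕ.≟ orbitMin x)
        ≡⟨ cong (λ L → ∑[ c ∈ map code L ] 𝟙 (c ℕ.≟ orbitMin x)) orbit≡ ⟩
      ∑[ c ∈ code x ∷ code (r x) ∷ code x ∷ code (r x) ∷ [] ] 𝟙 (c ℕ.≟ orbitMin x)
        ≡⟨ twice (𝟙 (code x ℕ.≟ orbitMin x)) (𝟙 (code (r x) ℕ.≟ orbitMin x)) ⟩
      2 * ∑[ c ∈ code x ∷ code (r x) ∷ [] ] 𝟙 (c ℕ.≟ orbitMin x)
        ≡⟨ cong (2 *_) (∑-δ-count ℕ._≟_ ((c₀≢c₁ ∷ []) ∷ [] ∷ []) μ∈) ⟩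
      2 ∎
      where
      open ≡-Reasoning
      twice : ∀ a b → a + (b + (a + (b + 0))) ≡ 2 * (a + (b + 0))
      twice = solve-∀
      orbit≡ : orbit x ≡ x ∷ r x ∷ x ∷ r x ∷ []
      orbit≡ = cong₂ (λ a b → x ∷ r x ∷ a ∷ b ∷ []) r²x≡x (cong r r²x≡x)
      c₀≢c₁ : code x ≢ code (r x)
      c₀≢c₁ e = rx≢x (sym (code-injective e))
      μ∈ : orbitMin x ∈ code x ∷ code (r x) ∷ []
      μ∈ with subst (λ L → orbitMin x ∈ map code L) orbit≡ (orbitMin-attained x)
      ... | here e                         = here e
      ... | there (here e)                 = there (here e)
      ... | there (there (here e))         = here e
      ... | there (there (there (here e))) = there (here e)

    ∑-orbit-free : ∀ x → r (r x) ≢ x → ∑[ y ∈ orbit x ] ⟦ canonical y ⟧ ≡ 1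
    ∑-orbit-free x r²x≢x =
      trans (canonical-orbit x) (∑-δ-count ℕ._≟_ (Unique.map⁺ code-injective orbit-unique) (orbitMin-attained x))
      where
      x≢rx : x ≢ r x
      x≢rx e = r²x≢x (trans (cong r (sym e)) (sym e))
      x≢r³x : x ≢ r (r (r x))
      x≢r³x e = x≢rx (trans (sym (r⁴ x)) (sym (cong r e)))
      rx≢r²x : r x ≢ r (r x)
      rx≢r²x e = x≢rx (r-injective e)
      orbit-unique : Unique (orbit x)
      orbit-unique = (x≢rx ∷ (r²x≢x ∘ sym) ∷ x≢r³x ∷ [])
                   ∷ (rx≢r²x ∷ (λ e → r²x≢x (sym (r-injective e))) ∷ [])
                   ∷ ((λ e → rx≢r²x (r-injective e)) ∷ [])
                   ∷ [] ∷ []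

    -- The right-hand side is the order of the stabiliser of x.
    ∑-orbit-canonical : ∀ x → ∑[ y ∈ orbit x ] ⟦ canonical y ⟧ ≡ 1 + 𝟙 (r (r x) ≟ x) + 2 * 𝟙 (r x ≟ x)
    ∑-orbit-canonical x with r x ≟ x | r (r x) ≟ x
    ... | yes rx≡x | yes _     = ∑-orbit-fixed x rx≡x
    ... | yes rx≡x | no r²x≢x  = ⊥-elim (r²x≢x (trans (cong r rx≡x) rx≡x))
    ... | no rx≢x  | yes r²x≡x = ∑-orbit-period-2 x rx≢x r²x≡x
    ... | no _     | no r²x≢x  = ∑-orbit-free x r²x≢x

    ∑-r : ∀ (f : X → ℕ) → ∑[ x ∈ elements ] f (r x) ≡ ∑ elements f
    ∑-r f = begin
      ∑[ x ∈ elements ] f (r x)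
        ≡⟨ ∑-cong elements (λ x → ∑-δ _≟_ f unique (complete (r x))) ⟨
      ∑[ x ∈ elements ] ∑[ y ∈ elements ] (f y * 𝟙 (y ≟ r x))
        ≡⟨ ∑-swap elements elements _ ⟩
      ∑[ y ∈ elements ] ∑[ x ∈ elements ] (f y * 𝟙 (y ≟ r x))
        ≡⟨ ∑-cong elements (λ y → ∑-cong elements (λ x → cong (f y *_) (𝟙-⇔ (y ≟ r x) (x ≟ r (r (r y))) preimage))) ⟩
      ∑[ y ∈ elements ] ∑[ x ∈ elements ] (f y * 𝟙 (x ≟ r (r (r y))))
        ≡⟨ ∑-cong elements (λ y → ∑-δ _≟_ (λ _ → f y) unique (complete (r (r (r y))))) ⟩
      ∑ elements f ∎
      where
      open ≡-Reasoning
      preimage : ∀ {x y} → y ≡ r x ⇔ x ≡ r (r (r y))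
      preimage {x} {y} = mk⇔ (λ e → trans (sym (r⁴ x)) (cong (λ z → r (r (r z))) (sym e)))
                             (λ e → sym (trans (cong r e) (r⁴ y)))

    module _ (w : X → ℕ) (w-r : ∀ x → w (r x) ≡ w x) where

      weighted : (X → ℕ) → ℕ
      weighted g = ∑[ x ∈ elements ] (w x * g x)

      weighted-r : ∀ g → weighted (λ x → g (r x)) ≡ weighted g
      weighted-r g = trans (∑-cong elements (λ x → cong (_* g (r x)) (sym (w-r x)))) (∑-r (λ x → w x * g x))

      burnside : 4 * weighted (λ x → ⟦ canonical x ⟧) ≡
                 ∑ elements w + weighted (λ x → 𝟙 (r (r x) ≟ x)) + 2 * weighted (λ x → 𝟙 (r x ≟ x))
      burnside = begin
        4 * weighted c
          ≡⟨ four (weighted c) ⟩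
        weighted c + (weighted c + (weighted c + weighted c))
          ≡⟨ cong (weighted c +_) (cong₂ _+_ (weighted-r c) (cong₂ _+_ (weighted-r² c) (weighted-r³ c))) ⟨
        weighted c + (weighted (c ∘ r) + (weighted (c ∘ r ∘ r) + weighted (c ∘ r ∘ r ∘ r)))
          ≡⟨ split-orbit ⟨
        ∑[ x ∈ elements ] (w x * ∑[ y ∈ orbit x ] c y)
          ≡⟨ ∑-cong elements (λ x → cong (w x *_) (∑-orbit-canonical x)) ⟩
        ∑[ x ∈ elements ] (w x * (1 + δ₂ x + 2 * δ₁ x))
          ≡⟨ split-stabiliser ⟩
        ∑ elements w + weighted δ₂ + 2 * weighted δ₁ ∎
        where
        open ≡-Reasoning
        c δ₁ δ₂ : X → ℕ
        c x = ⟦ canonical x ⟧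
        δ₁ x = 𝟙 (r x ≟ x)
        δ₂ x = 𝟙 (r (r x) ≟ x)
        four : ∀ s → 4 * s ≡ s + (s + (s + s))
        four = solve-∀
        weighted-r² : ∀ g → weighted (g ∘ r ∘ r) ≡ weighted g
        weighted-r² g = trans (weighted-r (g ∘ r)) (weighted-r g)
        weighted-r³ : ∀ g → weighted (g ∘ r ∘ r ∘ r) ≡ weighted g
        weighted-r³ g = trans (weighted-r (g ∘ r ∘ r)) (weighted-r² g)
        split-orbit : ∑[ x ∈ elements ] (w x * ∑[ y ∈ orbit x ] c y)
                      ≡ weighted c + (weighted (c ∘ r) + (weighted (c ∘ r ∘ r) + weighted (c ∘ r ∘ r ∘ r)))
        split-orbit =
          trans (∑-cong elements (λ x → distrib (w x) (c x) (c (r x)) (c (r (r x))) (c (r (r (r x))))))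
         (trans (∑-+ elements _ _) (cong (weighted c +_)
         (trans (∑-+ elements _ _) (cong (weighted (c ∘ r) +_) (∑-+ elements _ _)))))
          where
          distrib : ∀ w a b c d → w * (a + (b + (c + (d + 0)))) ≡ w * a + (w * b + (w * c + w * d))
          distrib = solve-∀
        split-stabiliser : ∑[ x ∈ elements ] (w x * (1 + δ₂ x + 2 * δ₁ x))
                           ≡ ∑ elements w + weighted δ₂ + 2 * weighted δ₁
        split-stabiliser =
          trans (∑-cong elements (λ x → distrib (w x) (δ₂ x) (δ₁ x)))
         (trans (∑-+ elements _ _) (cong₂ _+_ (∑-+ elements w _) (∑-*ˡ elements 2 _)))
          where
          distrib : ∀ w a b → w * (1 + a + 2 * b) ≡ w + w * a + 2 * (w * b)
          distrib = solve-∀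

  -- The border of the square

  iter-comm : ∀ m (f : A → A) x → iter m f (f x) ≡ f (iter m f x)
  iter-comm zero    f x = refl
  iter-comm (suc m) f x = cong f (iter-comm m f x)

  module Border (k : ℕ) where

    open Necklaces k

    n : ℕ
    n = suc (suc k)

    Position : Set
    Position = Fin 4 × Fin (suc k)

    turnSide : Fin 4 → Fin 4
    turnSide 0F = 1F
    turnSide 1F = 2F
    turnSide 2F = 3F
    turnSide 3F = 0F

    unturnSide : Fin 4 → Fin 4
    unturnSide 0F = 3F
    unturnSide 1F = 0F
    unturnSide 2F = 1F
    unturnSide 3F = 2F

    turnSide-unturnSide : ∀ q → turnSide (unturnSide q) ≡ q
    turnSide-unturnSide 0F = refl
    turnSide-unturnSide 1F = refl
    turnSide-unturnSide 2F = refl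
    turnSide-unturnSide 3F = refl

    unturnSide-turnSide : ∀ q → unturnSide (turnSide q) ≡ q
    unturnSide-turnSide 0F = refl
    unturnSide-turnSide 1F = refl
    unturnSide-turnSide 2F = refl
    unturnSide-turnSide 3F = refl

    turnSide-≢ : ∀ q → turnSide q ≢ q
    turnSide-≢ 0F ()
    turnSide-≢ 1F ()
    turnSide-≢ 2F ()
    turnSide-≢ 3F ()

    turnSide²-≢ : ∀ q → turnSide (turnSide q) ≢ q
    turnSide²-≢ 0F ()
    turnSide²-≢ 1F ()
    turnSide²-≢ 2F ()
    turnSide²-≢ 3F ()

    turn : Position → Position
    turn (q , r) = (turnSide q , r)

    unturn : Position → Position
    unturn (q , r) = (unturnSide q , r)

    turn-unturn : ∀ p → turn (unturn p) ≡ p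
    turn-unturn (q , r) = cong (_, r) (turnSide-unturnSide q)

    turn-injective : ∀ {p p′} → turn p ≡ turn p′ → p ≡ p′
    turn-injective {q , r} {q′ , r′} e =
      cong₂ _,_ (trans (sym (unturnSide-turnSide q)) (trans (cong (unturnSide ∘ proj₁) e) (unturnSide-turnSide q′)))
                (cong proj₂ e)

    -- Side q consists of the quarter turns of side q − 1; side 0 is the top row without its
    -- last cell.
    cell : Position → Cell n
    cell (q , r) = iter (toℕ q) rot (zero , inject₁ r)

    rot⁴ : ∀ (c : Cell n) → rot (rot (rot (rot c))) ≡ c
    rot⁴ (i , j) = cong₂ _,_ (Fin.opposite-involutive i) (Fin.opposite-involutive j)

    rot-rot⁻¹ : ∀ (c : Cell n) → rot (rot⁻¹ c) ≡ c
    rot-rot⁻¹ (i , j) = cong (i ,_) (Fin.opposite-involutive j)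

    rot⁻¹-rot : ∀ (c : Cell n) → rot⁻¹ (rot c) ≡ c
    rot⁻¹-rot (i , j) = cong (_, j) (Fin.opposite-involutive i)

    rot-cell : ∀ p → rot (cell p) ≡ cell (turn p)
    rot-cell (0F , r) = refl
    rot-cell (1F , r) = refl
    rot-cell (2F , r) = refl
    rot-cell (3F , r) = rot⁴ (zero , inject₁ r)

    rot⁻¹-cell : ∀ p → rot⁻¹ (cell p) ≡ cell (unturn p)
    rot⁻¹-cell p = begin
      rot⁻¹ (cell p)                ≡⟨ cong (rot⁻¹ ∘ cell) (turn-unturn p) ⟨
      rot⁻¹ (cell (turn (unturn p)))  ≡⟨ cong rot⁻¹ (rot-cell (unturn p)) ⟨
      rot⁻¹ (rot (cell (unturn p)))   ≡⟨ rot⁻¹-rot (cell (unturn p)) ⟩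
      cell (unturn p)               ∎
      where open ≡-Reasoning

    on-all-sides : ∀ (P : Position → Set) → (∀ p → P (turn p) → P p) → (∀ r → P (0F , r)) → ∀ p → P p
    on-all-sides P back side₀ (0F , r) = side₀ r
    on-all-sides P back side₀ (3F , r) = back (3F , r) (side₀ r)
    on-all-sides P back side₀ (2F , r) = back (2F , r) (back (3F , r) (side₀ r))
    on-all-sides P back side₀ (1F , r) = back (1F , r) (back (2F , r) (back (3F , r) (side₀ r)))

    succView : ∀ q {r : Fin (suc k)} → View r → Position
    succView q ‵fromℕ       = (turnSide q , zero)
    succView q (‵inject₁ i) = (q , suc i)

    succ : Position → Position
    succ (q , r) = succView q (view r)

    pred : Position → Position
    pred (q , zero)  = (unturnSide q , fromℕ k)
    pred (q , suc i) = (q , inject₁ i)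

    succ-fromℕ : ∀ q → succ (q , fromℕ k) ≡ (turnSide q , zero)
    succ-fromℕ q = cong (succView q) (view-fromℕ k)

    succ-inject₁ : ∀ q i → succ (q , inject₁ i) ≡ (q , suc i)
    succ-inject₁ q i = cong (succView q) (view-inject₁ i)

    pred-succ : ∀ p → pred (succ p) ≡ p
    pred-succ (q , r) with view r
    ... | ‵fromℕ     = cong (_, fromℕ k) (unturnSide-turnSide q)
    ... | ‵inject₁ i = refl

    succ-pred : ∀ p → succ (pred p) ≡ p
    succ-pred (q , zero)  = trans (succ-fromℕ (unturnSide q)) (cong (_, zero) (turnSide-unturnSide q))
    succ-pred (q , suc i) = succ-inject₁ q i

    succ-turn : ∀ p → succ (turn p) ≡ turn (succ p)
    succ-turn (q , r) with view r
    ... | ‵fromℕ     = refl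
    ... | ‵inject₁ i = refl

    pred-turn : ∀ p → pred (turn p) ≡ turn (pred p)
    pred-turn (q , zero)  = cong (_, fromℕ k) (trans (unturnSide-turnSide q) (sym (turnSide-unturnSide q)))
    pred-turn (q , suc r) = refl

    succ-side : ∀ p → proj₁ (succ p) ≡ proj₁ p ⊎ proj₁ (succ p) ≡ turnSide (proj₁ p)
    succ-side (q , r) with view r
    ... | ‵fromℕ     = inj₂ refl
    ... | ‵inject₁ i = inj₁ refl

    succ-offset : ∀ p → proj₁ (succ p) ≡ proj₁ p → toℕ (proj₂ (succ p)) ≡ suc (toℕ (proj₂ p))
    succ-offset (q , r) e with view r
    ... | ‵fromℕ     = ⊥-elim (turnSide-≢ q e)
    ... | ‵inject₁ i = cong suc (sym (Fin.toℕ-inject₁ i))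

    succ≢ : ∀ p → succ p ≢ p
    succ≢ p e with succ-side p
    ... | inj₁ s = ℕ.1+n≢n (trans (sym (succ-offset p s)) (cong (toℕ ∘ proj₂) e))
    ... | inj₂ s = turnSide-≢ (proj₁ p) (trans (sym s) (cong proj₁ e))

    succ²≢ : ∀ p → succ (succ p) ≢ p
    succ²≢ p e with succ-side p | succ-side (succ p)
    ... | inj₁ s₁ | inj₁ s₂ = ℕ.m≢1+n+m (toℕ (proj₂ p)) (trans (sym (cong (toℕ ∘ proj₂) e))
                                (trans (succ-offset (succ p) s₂) (cong suc (succ-offset p s₁))))
    ... | inj₁ s₁ | inj₂ s₂ = turnSide-≢ (proj₁ p) (trans (sym (trans s₂ (cong turnSide s₁))) (cong proj₁ e))
    ... | inj₂ s₁ | inj₁ s₂ = turnSide-≢ (proj₁ p) (trans (sym (trans s₂ s₁)) (cong proj₁ e))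
    ... | inj₂ s₁ | inj₂ s₂ = turnSide²-≢ (proj₁ p) (trans (sym (trans s₂ (cong turnSide s₁))) (cong proj₁ e))

    toℕ≤k : ∀ (r : Fin (suc k)) → toℕ r ≤ k
    toℕ≤k r = Fin.toℕ≤pred[n] r

    succ-from : ∀ q r r′ → toℕ r′ ≡ suc (toℕ r) → succ (q , r) ≡ (q , r′)
    succ-from q r r′ e with view r
    ... | ‵fromℕ     = ⊥-elim (ℕ.1+n≰n (subst (_≤ k) (trans e (cong suc (Fin.toℕ-fromℕ k))) (toℕ≤k r′)))
    ... | ‵inject₁ i = cong (q ,_) (Fin.toℕ-injective (trans (cong suc (sym (Fin.toℕ-inject₁ i))) (sym e)))

    succ-last : ∀ q r → toℕ r ≡ k → succ (q , r) ≡ (turnSide q , zero)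
    succ-last q r e = trans (cong (succ ∘ (q ,_)) (Fin.toℕ-injective (trans e (sym (Fin.toℕ-fromℕ k))))) (succ-fromℕ q)

    Neighbour-sym : ∀ {i j : Fin n} → Neighbour i j → Neighbour j i
    Neighbour-sym (inj₁ e) = inj₂ e
    Neighbour-sym (inj₂ e) = inj₁ e

    toℕ-opposite-suc : ∀ {i j : Fin n} → toℕ j ≡ suc (toℕ i) → toℕ (opposite i) ≡ suc (toℕ (opposite j))
    toℕ-opposite-suc {i} {j} e = begin
      toℕ (opposite i)           ≡⟨ Fin.opposite-prop i ⟩
      suc k ∸ toℕ i              ≡⟨ ℕ.+-∸-assoc 1 (ℕ.≤-pred (subst (_≤ suc k) e (Fin.toℕ≤pred[n] j))) ⟩
      suc (k ∸ toℕ i)            ≡⟨ cong (λ t → suc (suc k ∸ t)) e ⟨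
      suc (suc k ∸ toℕ j)        ≡⟨ cong suc (Fin.opposite-prop j) ⟨
      suc (toℕ (opposite j))     ∎
      where open ≡-Reasoning

    Neighbour-opposite : ∀ {i j : Fin n} → Neighbour i j → Neighbour (opposite i) (opposite j)
    Neighbour-opposite (inj₁ e) = inj₂ (toℕ-opposite-suc e)
    Neighbour-opposite (inj₂ e) = inj₁ (toℕ-opposite-suc e)

    Adjacent-sym : ∀ {c d : Cell n} → Adjacent c d → Adjacent d c
    Adjacent-sym (inj₁ (e , nb)) = inj₁ (sym e , Neighbour-sym nb)
    Adjacent-sym (inj₂ (e , nb)) = inj₂ (sym e , Neighbour-sym nb)

    Adjacent-rot : ∀ {c d : Cell n} → Adjacent c d → Adjacent (rot c) (rot d)
    Adjacent-rot (inj₁ (e , nb)) = inj₂ (cong opposite e , nb)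
    Adjacent-rot (inj₂ (e , nb)) = inj₁ (e , Neighbour-opposite nb)

    Adjacent-rot⁻ : ∀ {c d : Cell n} → Adjacent (rot c) (rot d) → Adjacent c d
    Adjacent-rot⁻ {c} {d} a = subst₂ Adjacent (rot⁴ c) (rot⁴ d) (Adjacent-rot (Adjacent-rot (Adjacent-rot a)))

    toℕ-opposite-last : ∀ {i : Fin n} → toℕ i ≡ suc k → toℕ (opposite i) ≡ 0
    toℕ-opposite-last {i} e = trans (Fin.opposite-prop i) (trans (cong (suc k ∸_) e) (ℕ.n∸n≡0 (suc k)))

    OnEdge-opposite : ∀ {i : Fin n} → OnEdge i → OnEdge (opposite i)
    OnEdge-opposite {i} (inj₁ e) = inj₂ (trans (Fin.opposite-prop i) (cong (suc k ∸_) e))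
    OnEdge-opposite {i} (inj₂ e) = inj₁ (toℕ-opposite-last e)

    InBorder-rot : ∀ {c : Cell n} → InBorder c → InBorder (rot c)
    InBorder-rot (inj₁ e) = inj₂ (OnEdge-opposite e)
    InBorder-rot (inj₂ e) = inj₁ e

    InBorder-cell : ∀ p → InBorder (cell p)
    InBorder-cell (q , r) = iterate (toℕ q)
      where
      iterate : ∀ m → InBorder (iter m rot (zero , inject₁ r))
      iterate zero    = inj₁ (inj₁ refl)
      iterate (suc m) = InBorder-rot (iterate m)

    toℕ-opposite-zero : toℕ (opposite (zero {suc k})) ≡ suc k
    toℕ-opposite-zero = Fin.opposite-prop zero

    toℕ-opposite-inject₁ : ∀ (r : Fin (suc k)) → toℕ (opposite (inject₁ r)) ≡ suc (k ∸ toℕ r)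
    toℕ-opposite-inject₁ r =
      trans (Fin.opposite-prop (inject₁ r)) (trans (cong (suc k ∸_) (Fin.toℕ-inject₁ r)) (ℕ.+-∸-assoc 1 (toℕ≤k r)))

    toℕ-inject₁≢suc-k : ∀ (r : Fin (suc k)) → toℕ (inject₁ r) ≢ suc k
    toℕ-inject₁≢suc-k r e = ℕ.1+n≰n (subst (_≤ k) (trans (sym (Fin.toℕ-inject₁ r)) e) (toℕ≤k r))

    cell-injective : ∀ p p′ → cell p ≡ cell p′ → p ≡ p′
    cell-injective = on-all-sides (λ p → ∀ p′ → cell p ≡ cell p′ → p ≡ p′) step-inj side₀
      where
      step-inj : ∀ p → (∀ p′ → cell (turn p) ≡ cell p′ → turn p ≡ p′) → ∀ p′ → cell p ≡ cell p′ → p ≡ p′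
      step-inj p h p′ e = turn-injective (h (turn p′) (trans (sym (rot-cell p)) (trans (cong rot e) (rot-cell p′))))
      side₀ : ∀ r p′ → cell (0F , r) ≡ cell p′ → (0F , r) ≡ p′
      side₀ r (0F , r′) e = cong (0F ,_) (Fin.inject₁-injective (cong proj₂ e))
      side₀ r (1F , r′) e = ⊥-elim (toℕ-inject₁≢suc-k r (trans (cong (toℕ ∘ proj₂) e) toℕ-opposite-zero))
      side₀ r (2F , r′) e = ⊥-elim (ℕ.0≢1+n (trans (cong (toℕ ∘ proj₁) e) toℕ-opposite-zero))
      side₀ r (3F , r′) e = ⊥-elim (ℕ.0≢1+n (trans (cong (toℕ ∘ proj₁) e) (toℕ-opposite-inject₁ r′)))

    preimage-rot : ∀ {c} → Σ Position (λ p → cell p ≡ rot c) → Σ Position (λ p → cell p ≡ c)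
    preimage-rot {c} (p , e) = unturn p , trans (sym (rot⁻¹-cell p)) (trans (cong rot⁻¹ e) (rot⁻¹-rot c))

    preimage-top : ∀ {i j : Fin n} → toℕ i ≡ 0 → Σ Position (λ p → cell p ≡ (i , j))
    preimage-top {i} {j} e with toℕ j ℕ.≟ suc k
    ... | yes e′ = (1F , zero) ,
                   cong₂ _,_ (sym (Fin.toℕ-injective e)) (Fin.toℕ-injective (trans toℕ-opposite-zero (sym e′)))
    ... | no ne  = (0F , lower₁ j (ne ∘ sym)) ,
                   cong₂ _,_ (sym (Fin.toℕ-injective e)) (Fin.inject₁-lower₁ j (ne ∘ sym))

    cell-surjective : ∀ c → InBorder c → Σ Position (λ p → cell p ≡ c)
    cell-surjective c (inj₁ (inj₁ e)) = preimage-top e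
    cell-surjective c (inj₁ (inj₂ e)) = preimage-rot (preimage-rot (preimage-top (toℕ-opposite-last e)))
    cell-surjective c (inj₂ (inj₁ e)) = preimage-rot (preimage-top e)
    cell-surjective c (inj₂ (inj₂ e)) = preimage-rot (preimage-rot (preimage-rot (preimage-top (toℕ-opposite-last e))))

    adjacent⇒succ : ∀ p p′ → Adjacent (cell p) (cell p′) → p′ ≡ succ p ⊎ p ≡ succ p′
    adjacent⇒succ = on-all-sides (λ p → ∀ p′ → Adjacent (cell p) (cell p′) → p′ ≡ succ p ⊎ p ≡ succ p′) step-adj side₀
      where
      step-adj : ∀ p → (∀ p′ → Adjacent (cell (turn p)) (cell p′) → p′ ≡ succ (turn p) ⊎ turn p ≡ succ p′) →
                 ∀ p′ → Adjacent (cell p) (cell p′) → p′ ≡ succ p ⊎ p ≡ succ p′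
      step-adj p h p′ a =
        Sum.map (λ e → turn-injective (trans e (succ-turn p))) (λ e → turn-injective (trans e (succ-turn p′)))
                (h (turn p′) (subst₂ Adjacent (rot-cell p) (rot-cell p′) (Adjacent-rot a)))
      side₀ : ∀ r p′ → Adjacent (cell (0F , r)) (cell p′) → p′ ≡ succ (0F , r) ⊎ (0F , r) ≡ succ p′
      side₀ r (0F , r′) (inj₁ (_ , inj₁ e)) =
        inj₁ (sym (succ-from 0F r r′ (trans (sym (Fin.toℕ-inject₁ r′)) (trans e (cong suc (Fin.toℕ-inject₁ r))))))
      side₀ r (0F , r′) (inj₁ (_ , inj₂ e)) =
        inj₂ (sym (succ-from 0F r′ r (trans (sym (Fin.toℕ-inject₁ r)) (trans e (cong suc (Fin.toℕ-inject₁ r′))))))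
      side₀ r (0F , r′) (inj₂ (_ , inj₁ ()))
      side₀ r (0F , r′) (inj₂ (_ , inj₂ ()))
      side₀ r (1F , r′) (inj₁ (same-row , inj₁ e)) =
        inj₁ (trans (cong (1F ,_) r′≡0) (sym (succ-last 0F r
          (ℕ.suc-injective (trans (cong suc (sym (Fin.toℕ-inject₁ r))) (trans (sym e) toℕ-opposite-zero))))))
        where
        r′≡0 : r′ ≡ zero
        r′≡0 = Fin.toℕ-injective (trans (sym (Fin.toℕ-inject₁ r′)) (sym (cong toℕ same-row)))
      side₀ r (1F , r′) (inj₁ (_ , inj₂ e)) =
        ⊥-elim (ℕ.1+n≰n (ℕ.≤-trans (subst (_≤ k) (trans (sym (Fin.toℕ-inject₁ r)) (trans e (cong suc toℕ-opposite-zero)))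
                                          (toℕ≤k r))
                                   (ℕ.n≤1+n k)))
      side₀ r (1F , r′) (inj₂ (e , _)) = ⊥-elim (toℕ-inject₁≢suc-k r (trans (cong toℕ e) toℕ-opposite-zero))
      side₀ r (2F , r′) (inj₁ (e , _)) = ⊥-elim (ℕ.0≢1+n (trans (cong toℕ e) toℕ-opposite-zero))
      side₀ r (2F , r′) (inj₂ (e , inj₁ nb)) =
        ⊥-elim (ℕ.0≢1+n (trans (sym r≡0) (trans (sym (Fin.toℕ-inject₁ r)) (trans (cong toℕ e) (toℕ-opposite-inject₁ r′)))))
        where
        r≡0 : toℕ r ≡ 0
        r≡0 = ℕ.n≤0⇒n≡0 (subst (toℕ r ≤_) (ℕ.suc-injective (trans (sym toℕ-opposite-zero) nb)) (toℕ≤k r))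
      side₀ r (2F , r′) (inj₂ (e , inj₂ ()))
      side₀ r (3F , r′) (inj₁ (e , _)) = ⊥-elim (ℕ.0≢1+n (trans (cong toℕ e) (toℕ-opposite-inject₁ r′)))
      side₀ r (3F , r′) (inj₂ (e , inj₁ nb)) = inj₂ (trans (cong (0F ,_) r≡0) (sym (succ-last 3F r′ r′≡k)))
        where
        r≡0 : r ≡ zero
        r≡0 = Fin.toℕ-injective (trans (sym (Fin.toℕ-inject₁ r))
                                       (trans (cong toℕ e) (cong toℕ (Fin.opposite-involutive (zero {suc k})))))
        r′≡k : toℕ r′ ≡ k
        r′≡k = ℕ.≤-antisym (toℕ≤k r′) (ℕ.m∸n≡0⇒m≤n (ℕ.suc-injective (trans (sym (toℕ-opposite-inject₁ r′)) nb)))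
      side₀ r (3F , r′) (inj₂ (e , inj₂ ()))

    adjacent-succ : ∀ p → Adjacent (cell p) (cell (succ p))
    adjacent-succ = on-all-sides (λ p → Adjacent (cell p) (cell (succ p))) step-adj side₀
      where
      step-adj : ∀ p → Adjacent (cell (turn p)) (cell (succ (turn p))) → Adjacent (cell p) (cell (succ p))
      step-adj p a =
        Adjacent-rot⁻ (subst₂ Adjacent (sym (rot-cell p)) (trans (cong cell (succ-turn p)) (sym (rot-cell (succ p)))) a)
      side₀ : ∀ r → Adjacent (cell (0F , r)) (cell (succ (0F , r)))
      side₀ r with view r
      ... | ‵fromℕ     =
        inj₁ (refl , inj₁ (trans toℕ-opposite-zero (cong suc (sym (trans (Fin.toℕ-inject₁ (fromℕ k)) (Fin.toℕ-fromℕ k))))))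
      ... | ‵inject₁ i = inj₁ (refl , inj₁ (cong suc (sym (Fin.toℕ-inject₁ (inject₁ i)))))

    adjacent-pred : ∀ p → Adjacent (cell p) (cell (pred p))
    adjacent-pred p = Adjacent-sym (subst (λ p′ → Adjacent (cell (pred p)) (cell p′)) (succ-pred p) (adjacent-succ (pred p)))

    -- Tilings as necklaces

    block : Necklace → Fin 4 → Block
    block (a , b , c , d) 0F = a
    block (a , b , c , d) 1F = b
    block (a , b , c , d) 2F = c
    block (a , b , c , d) 3F = d

    bit : Necklace → Position → Bool
    bit x (q , r) = lookup (block x q) r

    bit-ρ : ∀ x p → bit (ρ x) (turn p) ≡ bit x p
    bit-ρ (a , b , c , d) (0F , r) = refl
    bit-ρ (a , b , c , d) (1F , r) = refl
    bit-ρ (a , b , c , d) (2F , r) = refl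
    bit-ρ (a , b , c , d) (3F , r) = refl

    necklace-ext : ∀ x y → (∀ p → bit x p ≡ bit y p) → x ≡ y
    necklace-ext (a , b , c , d) (a′ , b′ , c′ , d′) h
      rewrite lookup-ext a a′ (λ i → h (0F , i)) | lookup-ext b b′ (λ i → h (1F , i))
            | lookup-ext c c′ (λ i → h (2F , i)) | lookup-ext d d′ (λ i → h (3F , i)) = refl

    _≟ᶜ_ : DecidableEquality (Cell n)
    _≟ᶜ_ = Product.≡-dec Fin._≟_ Fin._≟_

    pairedWithSucc : (Cell n → Cell n) → Position → Bool
    pairedWithSucc f p = does (f (cell p) ≟ᶜ cell (succ p))

    encode : (Cell n → Cell n) → Necklace
    encode f = (side 0F , side 1F , side 2F , side 3F)
      where
      side : Fin 4 → Block
      side q = tabulate (λ r → pairedWithSucc f (q , r))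

    bit-encode : ∀ f p → bit (encode f) p ≡ pairedWithSucc f p
    bit-encode f (0F , r) = Vec.lookup∘tabulate (λ r → pairedWithSucc f (0F , r)) r
    bit-encode f (1F , r) = Vec.lookup∘tabulate (λ r → pairedWithSucc f (1F , r)) r
    bit-encode f (2F , r) = Vec.lookup∘tabulate (λ r → pairedWithSucc f (2F , r)) r
    bit-encode f (3F , r) = Vec.lookup∘tabulate (λ r → pairedWithSucc f (3F , r)) r

    -- bit x p says that the cells at p and at succ p form one 2 × 1 rod.
    partnerPos : Necklace → Position → Position
    partnerPos x p = if bit x p then succ p else (if bit x (pred p) then pred p else p)

    InBorder? : (c : Cell n) → Dec (InBorder c)
    InBorder? (i , j) = OnEdge? i ⊎-dec OnEdge? j
      where
      OnEdge? : (i : Fin n) → Dec (OnEdge i)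
      OnEdge? i = (toℕ i ℕ.≟ 0) ⊎-dec (toℕ i ℕ.≟ suc k)

    positionOf : (c : Cell n) → InBorder c → Position
    positionOf c b = proj₁ (cell-surjective c b)

    cell-positionOf : ∀ c b → cell (positionOf c b) ≡ c
    cell-positionOf c b = proj₂ (cell-surjective c b)

    positionOf-cell : ∀ p b → positionOf (cell p) b ≡ p
    positionOf-cell p b = cell-injective (positionOf (cell p) b) p (cell-positionOf (cell p) b)

    partnerCell : Necklace → Cell n → Cell n
    partnerCell x c with InBorder? c
    ... | yes b = cell (partnerPos x (positionOf c b))
    ... | no _ = c

    partnerCell-outside : ∀ x c → ¬ InBorder c → partnerCell x c ≡ c
    partnerCell-outside x c nb with InBorder? c
    ... | yes b = ⊥-elim (nb b)
    ... | no _ = refl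

    partnerCell-border : ∀ x c (b : InBorder c) → partnerCell x c ≡ cell (partnerPos x (positionOf c b))
    partnerCell-border x c b with InBorder? c
    ... | yes b′ = cong (cell ∘ partnerPos x)
                        (cell-injective (positionOf c b′) (positionOf c b) (trans (cell-positionOf c b′) (sym (cell-positionOf c b))))
    ... | no nb = ⊥-elim (nb b)

    partnerCell-cell : ∀ x p → partnerCell x (cell p) ≡ cell (partnerPos x p)
    partnerCell-cell x p =
      trans (partnerCell-border x (cell p) (InBorder-cell p)) (cong (cell ∘ partnerPos x) (positionOf-cell p (InBorder-cell p)))

    bit-pred : ∀ x q r → bit x (pred (q , r)) ≡ lookup (last (block x (unturnSide q)) ∷ block x q) (inject₁ r)
    bit-pred x q zero    = lookup-fromℕ (block x (unturnSide q))
    bit-pred x q (suc r) = refl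

    private
      module Sides (a b c d : Block) where
        p₀ = sparseAfter (last d) a
        p₁ = sparseAfter (last a) b
        p₂ = sparseAfter (last b) c
        p₃ = sparseAfter (last c) d

    valid⇒sides : ∀ x → valid x ≡ true → ∀ q → sparseAfter (last (block x (unturnSide q))) (block x q) ≡ true
    valid⇒sides (a , b , c , d) h 0F = ∧-conicalʳ p₃ p₀ (∧-conicalʳ p₂ _ (∧-conicalʳ p₁ _ h))
      where open Sides a b c d
    valid⇒sides (a , b , c , d) h 1F = ∧-conicalˡ p₁ _ h
      where open Sides a b c d
    valid⇒sides (a , b , c , d) h 2F = ∧-conicalˡ p₂ _ (∧-conicalʳ p₁ _ h)
      where open Sides a b c d
    valid⇒sides (a , b , c , d) h 3F = ∧-conicalˡ p₃ p₀ (∧-conicalʳ p₂ _ (∧-conicalʳ p₁ _ h))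
      where open Sides a b c d

    sides⇒valid : ∀ x → (∀ q → sparseAfter (last (block x (unturnSide q))) (block x q) ≡ true) → valid x ≡ true
    sides⇒valid (a , b , c , d) h = cong₂ _∧_ (h 1F) (cong₂ _∧_ (h 2F) (cong₂ _∧_ (h 3F) (h 0F)))

    NoAdjacent : Necklace → Set
    NoAdjacent x = ∀ p → bit x p ∧ bit x (succ p) ≡ false

    valid⇒NoAdjacent : ∀ x → valid x ≡ true → NoAdjacent x
    valid⇒NoAdjacent x h p = subst (λ z → bit x z ∧ bit x (succ p) ≡ false) (pred-succ p) (after-pred (succ p))
      where
      after-pred : ∀ p → bit x (pred p) ∧ bit x p ≡ false
      after-pred (q , r) = trans (cong (_∧ bit x (q , r)) (bit-pred x q r)) (sparseAfter-sound _ (block x q) (valid⇒sides x h q) r)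

    NoAdjacent⇒valid : ∀ x → NoAdjacent x → valid x ≡ true
    NoAdjacent⇒valid x h = sides⇒valid x (λ q → sparseAfter-complete _ (block x q) (λ r →
      trans (cong (_∧ bit x (q , r)) (sym (bit-pred x q r)))
            (subst (λ z → bit x (pred (q , r)) ∧ bit x z ≡ false) (succ-pred (q , r)) (h (pred (q , r))))))

    partnerCell-rod : ∀ x p →
      partnerCell x (cell p) ≡ cell p ⊎ (InBorder (partnerCell x (cell p)) × Adjacent (cell p) (partnerCell x (cell p)))
    partnerCell-rod x p rewrite partnerCell-cell x p with bit x p
    ... | true = inj₂ (InBorder-cell (succ p) , adjacent-succ p)
    ... | false with bit x (pred p)
    ...   | true  = inj₂ (InBorder-cell (pred p) , adjacent-pred p)
    ...   | false = inj₁ refl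

    partnerPos-involutive : ∀ x → NoAdjacent x → ∀ p → partnerPos x (partnerPos x p) ≡ p
    partnerPos-involutive x noAdjacent p with bit x p in e₁
    ... | true rewrite trans (sym (cong (_∧ bit x (succ p)) e₁)) (noAdjacent p) | pred-succ p | e₁ = refl
    ... | false with bit x (pred p) in e₂
    ...   | true  rewrite e₂ | succ-pred p = refl
    ...   | false rewrite e₁ | e₂ = refl

    partnerCell-involutive : ∀ x → NoAdjacent x → ∀ p → partnerCell x (partnerCell x (cell p)) ≡ cell p
    partnerCell-involutive x noAdjacent p rewrite partnerCell-cell x p | partnerCell-cell x (partnerPos x p) =
      cong cell (partnerPos-involutive x noAdjacent p)

    tiling : ∀ x → valid x ≡ true → Tiling n
    tiling x v = record
      { partner    = partnerCell x
      ; outside    = partnerCell-outside x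
      ; rod        = λ c b → subst (λ z → partnerCell x z ≡ z ⊎ (InBorder (partnerCell x z) × Adjacent z (partnerCell x z)))
                                   (cell-positionOf c b) (partnerCell-rod x (positionOf c b))
      ; involutive = λ c b → subst (λ z → partnerCell x (partnerCell x z) ≡ z)
                                   (cell-positionOf c b) (partnerCell-involutive x (valid⇒NoAdjacent x v) (positionOf c b))
      }

    bit-partnerCell : ∀ x p → does (partnerCell x (cell p) ≟ᶜ cell (succ p)) ≡ bit x p
    bit-partnerCell x p rewrite partnerCell-cell x p with bit x p
    ... | true = dec-true (cell (succ p) ≟ᶜ cell (succ p)) refl
    ... | false with bit x (pred p)
    ...   | true  = dec-false (cell (pred p) ≟ᶜ cell (succ p))
                      (λ e → succ²≢ p (sym (trans (sym (succ-pred p)) (cong succ (cell-injective (pred p) (succ p) e)))))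
    ...   | false = dec-false (cell p ≟ᶜ cell (succ p)) (λ e → succ≢ p (sym (cell-injective p (succ p) e)))

    encode-partnerCell : ∀ x → encode (partnerCell x) ≡ x
    encode-partnerCell x = necklace-ext _ x (λ p → trans (bit-encode (partnerCell x) p) (bit-partnerCell x p))

    encode-valid : ∀ (t : Tiling n) → valid (encode (partner t)) ≡ true
    encode-valid t = NoAdjacent⇒valid (encode π) noAdjacent
      where
      π = partner t
      noAdjacent : NoAdjacent (encode π)
      noAdjacent p rewrite bit-encode π p | bit-encode π (succ p) with π (cell p) ≟ᶜ cell (succ p)
      ... | no _ = refl
      ... | yes e with π (cell (succ p)) ≟ᶜ cell (succ (succ p))
      ...   | no _ = refl
      ...   | yes e₂ = ⊥-elim (succ²≢ p (sym (cell-injective p (succ (succ p))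
                         (trans (sym (involutive t (cell p) (InBorder-cell p))) (trans (cong π e) e₂)))))

    encode-cong : ∀ {f g} → (∀ c → f c ≡ g c) → encode f ≡ encode g
    encode-cong {f} {g} f≗g = necklace-ext (encode f) (encode g) (λ p →
      trans (bit-encode f p) (trans (cong (λ z → does (z ≟ᶜ cell (succ p))) (f≗g (cell p))) (sym (bit-encode g p))))

    ≗-on-border : ∀ {f g : Cell n → Cell n} →
                  (∀ c → ¬ InBorder c → f c ≡ g c) → (∀ p → f (cell p) ≡ g (cell p)) → ∀ c → f c ≡ g c
    ≗-on-border {f} {g} off-border on-cells c with InBorder? c
    ... | yes c∈ = subst (λ z → f z ≡ g z) (cell-positionOf c c∈) (on-cells (positionOf c c∈))
    ... | no c∉  = off-border c c∉

    partnerCell-encode : ∀ (t : Tiling n) c → partnerCell (encode (partner t)) c ≡ partner t c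
    partnerCell-encode t = ≗-on-border (λ c c∉ → trans (partnerCell-outside (encode π) c c∉) (sym (outside t c c∉))) on-cells
      where
      π = partner t
      on-cells : ∀ p → partnerCell (encode π) (cell p) ≡ π (cell p)
      on-cells p rewrite partnerCell-cell (encode π) p | bit-encode π p | bit-encode π (pred p)
        with π (cell p) ≟ᶜ cell (succ p)
      ... | yes e = sym e
      ... | no not-succ with π (cell (pred p)) ≟ᶜ cell (succ (pred p))
      ...   | yes e₂ =
        sym (trans (cong π (sym (trans e₂ (cong cell (succ-pred p))))) (involutive t (cell (pred p)) (InBorder-cell (pred p))))
      ...   | no not-pred with rod t (cell p) (InBorder-cell p)
      ...     | inj₁ e = sym e
      ...     | inj₂ (π-p∈ , adjacent)
        with adjacent⇒succ p (positionOf (π (cell p)) π-p∈)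
                             (subst (Adjacent (cell p)) (sym (cell-positionOf (π (cell p)) π-p∈)) adjacent)
      ...       | inj₁ e = ⊥-elim (not-succ (trans (sym (cell-positionOf (π (cell p)) π-p∈)) (cong cell e)))
      ...       | inj₂ e =
        ⊥-elim (not-pred (trans (cong π (sym π-p≡)) (trans (involutive t (cell p) (InBorder-cell p)) (cong cell (sym (succ-pred p))))))
        where
        π-p≡ : π (cell p) ≡ cell (pred p)
        π-p≡ = trans (sym (cell-positionOf (π (cell p)) π-p∈))
                     (cong cell (trans (sym (pred-succ (positionOf (π (cell p)) π-p∈))) (cong pred (sym e))))


    partnerPos-ρ : ∀ x p → partnerPos (ρ x) (turn p) ≡ turn (partnerPos x p)
    partnerPos-ρ x p rewrite bit-ρ x p | pred-turn p | bit-ρ x (pred p) | succ-turn p with bit x p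
    ... | true = refl
    ... | false with bit x (pred p)
    ...   | true = refl
    ...   | false = refl

    partnerCell-ρ : ∀ x c → partnerCell (ρ x) c ≡ rot (partnerCell x (rot⁻¹ c))
    partnerCell-ρ x = ≗-on-border off-border on-cells
      where
      off-border : ∀ c → ¬ InBorder c → partnerCell (ρ x) c ≡ rot (partnerCell x (rot⁻¹ c))
      off-border c c∉ = trans (partnerCell-outside (ρ x) c c∉)
        (sym (trans (cong rot (partnerCell-outside x (rot⁻¹ c) (c∉ ∘ subst InBorder (rot-rot⁻¹ c) ∘ InBorder-rot))) (rot-rot⁻¹ c)))
      on-cells : ∀ p → partnerCell (ρ x) (cell p) ≡ rot (partnerCell x (rot⁻¹ (cell p)))
      on-cells p = begin
        partnerCell (ρ x) (cell p)                 ≡⟨ partnerCell-cell (ρ x) p ⟩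
        cell (partnerPos (ρ x) p)                  ≡⟨ cong (cell ∘ partnerPos (ρ x)) (turn-unturn p) ⟨
        cell (partnerPos (ρ x) (turn (unturn p)))  ≡⟨ cong cell (partnerPos-ρ x (unturn p)) ⟩
        cell (turn (partnerPos x (unturn p)))      ≡⟨ rot-cell (partnerPos x (unturn p)) ⟨
        rot (cell (partnerPos x (unturn p)))       ≡⟨ cong rot (partnerCell-cell x (unturn p)) ⟨
        rot (partnerCell x (cell (unturn p)))      ≡⟨ cong (rot ∘ partnerCell x) (rot⁻¹-cell p) ⟨
        rot (partnerCell x (rot⁻¹ (cell p)))       ∎
        where open ≡-Reasoning

    partnerCell-iter : ∀ m x c → partnerCell (iter m ρ x) c ≡ iter m rot (partnerCell x (iter m rot⁻¹ c))
    partnerCell-iter zero    x c = refl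
    partnerCell-iter (suc m) x c = begin
      partnerCell (ρ (iter m ρ x)) c                              ≡⟨ partnerCell-ρ (iter m ρ x) c ⟩
      rot (partnerCell (iter m ρ x) (rot⁻¹ c))                    ≡⟨ cong rot (partnerCell-iter m x (rot⁻¹ c)) ⟩
      rot (iter m rot (partnerCell x (iter m rot⁻¹ (rot⁻¹ c))))   ≡⟨ cong (rot ∘ iter m rot ∘ partnerCell x) (iter-comm m rot⁻¹ c) ⟩
      rot (iter m rot (partnerCell x (rot⁻¹ (iter m rot⁻¹ c))))   ∎
      where open ≡-Reasoning


  -- Counting the orbits

  formula-Q^ : ∀ m → let Qₘ = Q ^ suc m in
    ℤ.+ (trace (Qₘ ⊗ Qₘ ⊗ Qₘ ⊗ Qₘ) + trace (Qₘ ⊗ Qₘ) + 2 * trace Qₘ) ≡ formula (suc (suc m))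
  formula-Q^ m = begin
    ℤ.+ (trace (Qₘ ⊗ Qₘ ⊗ Qₘ ⊗ Qₘ) + trace (Qₘ ⊗ Qₘ) + 2 * trace Qₘ)
      ≡⟨ trans (pos-+ (trace (Qₘ ⊗ Qₘ ⊗ Qₘ ⊗ Qₘ) + trace (Qₘ ⊗ Qₘ)) (2 * trace Qₘ))
               (cong₂ ℤ._+_ (pos-+ (trace (Qₘ ⊗ Qₘ ⊗ Qₘ ⊗ Qₘ)) (trace (Qₘ ⊗ Qₘ))) (pos-* 2 (trace Qₘ))) ⟩
    ℤ.+ trace (Qₘ ⊗ Qₘ ⊗ Qₘ ⊗ Qₘ) ℤ.+ ℤ.+ trace (Qₘ ⊗ Qₘ) ℤ.+ ℤ.+ 2 ℤ.* ℤ.+ trace Qₘ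
      ≡⟨ cong₂ (λ a b → a ℤ.+ b ℤ.+ ℤ.+ 2 ℤ.* ℤ.+ trace Qₘ)
               (trans (trace-⊗⁴ Qₘ) (cong (λ s → s ℤ.* s ℤ.- ℤ.+ 2 ℤ.* (det Qₘ ℤ.* det Qₘ)) (trace-⊗-self Qₘ)))
               (trace-⊗-self Qₘ) ⟩
    polynomial (ℤ.+ trace Qₘ) (det Qₘ)
      ≡⟨ cong₂ polynomial (cong ℤ.+_ (trace-Q^ (suc m))) (det-Q^ (suc m)) ⟩
    polynomial (x (suc (suc m))) (sgn (suc m))
      ≡⟨ orbit-polynomial (x (suc (suc m))) (sgn (suc m)) (sgn-square (suc m)) ⟩
    formula (suc (suc m)) ∎
    where
    open ≡-Reasoning
    Qₘ = Q ^ suc m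
    polynomial : ℤ → ℤ → ℤ
    polynomial t δ =
      (t ℤ.* t ℤ.- ℤ.+ 2 ℤ.* δ) ℤ.* (t ℤ.* t ℤ.- ℤ.+ 2 ℤ.* δ) ℤ.- ℤ.+ 2 ℤ.* (δ ℤ.* δ)
        ℤ.+ (t ℤ.* t ℤ.- ℤ.+ 2 ℤ.* δ) ℤ.+ ℤ.+ 2 ℤ.* t

  module Orbits (k : ℕ) where
    open Necklaces k
    open Border k
    open C₄-Burnside _≟ₙ_ necklaces ∈-necklaces necklaces-unique ρ (λ _ → refl)

    representative : Necklace → Bool
    representative x = valid x ∧ canonical x

    representatives : List Necklace
    representatives = filter (λ x → T? (representative x)) necklaces

    orbitCount : ℕ
    orbitCount = length representatives

    representative-lookup : ∀ i → T (valid (List.lookup representatives i)) × T (canonical (List.lookup representatives i))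
    representative-lookup i =
      Equivalence.to T-∧ (proj₂ (∈-filter⁻ (λ x → T? (representative x)) {xs = necklaces} (∈-lookup i)))

    tilingOf : Fin orbitCount → Tiling n
    tilingOf i = tiling (List.lookup representatives i) (Equivalence.to T-≡ (proj₁ (representative-lookup i)))

    tilingOf-surjective : ∀ t → ∃[ i ] SameOrbit t (tilingOf i)
    tilingOf-surjective t = Any.index y∈ , j , λ c → begin
      partnerCell (List.lookup representatives (Any.index y∈)) c
        ≡⟨ cong (λ z → partnerCell z c) (lookup-index y∈) ⟨
      partnerCell (iter (toℕ j) ρ xₜ) c
        ≡⟨ partnerCell-iter (toℕ j) xₜ c ⟩
      iter (toℕ j) rot (partnerCell xₜ (iter (toℕ j) rot⁻¹ c))
        ≡⟨ cong (iter (toℕ j) rot) (partnerCell-encode t (iter (toℕ j) rot⁻¹ c)) ⟩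
      iter (toℕ j) rot (partner t (iter (toℕ j) rot⁻¹ c)) ∎
      where
      open ≡-Reasoning
      xₜ = encode (partner t)
      j = proj₁ (canonical-exists xₜ)
      y∈ : iter (toℕ j) ρ xₜ ∈ representatives
      y∈ = ∈-filter⁺ (λ x → T? (representative x)) (∈-necklaces _)
             (Equivalence.from T-∧ (Equivalence.from T-≡ (trans (valid-iter (toℕ j) xₜ) (encode-valid t)) ,
                                    proj₂ (canonical-exists xₜ)))

    tilingOf-injective : ∀ i j → SameOrbit (tilingOf i) (tilingOf j) → i ≡ j
    tilingOf-injective i j (q , same) =
      lookup-injective (Unique.filter⁺ (λ x → T? (representative x)) necklaces-unique) i j (sym yⱼ≡yᵢ)
      where
      open ≡-Reasoning
      yᵢ = List.lookup representatives i
      yⱼ = List.lookup representatives j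
      yⱼ≡ρ^q-yᵢ : yⱼ ≡ iter (toℕ q) ρ yᵢ
      yⱼ≡ρ^q-yᵢ = begin
        yⱼ                                   ≡⟨ encode-partnerCell yⱼ ⟨
        encode (partnerCell yⱼ)              ≡⟨ encode-cong (λ c → trans (same c) (sym (partnerCell-iter (toℕ q) yᵢ c))) ⟩
        encode (partnerCell (iter (toℕ q) ρ yᵢ)) ≡⟨ encode-partnerCell _ ⟩
        iter (toℕ q) ρ yᵢ                    ∎
      yⱼ≡yᵢ : yⱼ ≡ yᵢ
      yⱼ≡yᵢ = trans yⱼ≡ρ^q-yᵢ (canonical-unique (toℕ q) yᵢ (proj₂ (representative-lookup i))
                                  (subst (T ∘ canonical) yⱼ≡ρ^q-yᵢ (proj₂ (representative-lookup j))))

    orbitCount-burnside : 4 * orbitCount ≡ trace (Qₖ ⊗ Qₖ ⊗ Qₖ ⊗ Qₖ) + trace (Qₖ ⊗ Qₖ) + 2 * trace Qₖ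
    orbitCount-burnside = begin
      4 * orbitCount
        ≡⟨ cong (4 *_) (trans (length-filter representative necklaces) (∑-cong necklaces (λ x → ⟦∧⟧ (valid x) (canonical x)))) ⟩
      4 * ∑[ x ∈ necklaces ] (⟦ valid x ⟧ * ⟦ canonical x ⟧)
        ≡⟨ burnside (λ x → ⟦ valid x ⟧) (λ x → cong ⟦_⟧ (valid-ρ x)) ⟩
      ∑[ x ∈ necklaces ] ⟦ valid x ⟧ + ∑[ x ∈ necklaces ] (⟦ valid x ⟧ * 𝟙 (ρ (ρ x) ≟ₙ x))
        + 2 * ∑[ x ∈ necklaces ] (⟦ valid x ⟧ * 𝟙 (ρ x ≟ₙ x))
        ≡⟨ cong₂ _+_ (cong₂ _+_ count-valid count-valid-ρ²-fixed) (cong (2 *_) count-valid-ρ-fixed) ⟩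
      trace (Qₖ ⊗ Qₖ ⊗ Qₖ ⊗ Qₖ) + trace (Qₖ ⊗ Qₖ) + 2 * trace Qₖ ∎
      where open ≡-Reasoning

    orbitCount-formula : ℤ.+ 4 ℤ.* ℤ.+ orbitCount ≡ formula n
    orbitCount-formula = trans (sym (pos-* 4 orbitCount)) (trans (cong ℤ.+_ orbitCount-burnside) (formula-Q^ k))

open import Data.Nat using (ℕ; suc; _≤_; z≤n; s≤s)
open import Data.Integer using (ℤ; +_; _*_)
open import Data.Product using (∃; _×_; _,_)
open import Relation.Binary.PropositionalEquality using (_≡_)

mainTheorem3 : ∀ (n : ℕ) → 2 ≤ n →
    ∃ λ m → NumOrbits n m × (+ 4 * + m ≡ formula n)
mainTheorem3 (suc (suc k)) (s≤s (s≤s z≤n)) =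
  orbitCount , (tilingOf , tilingOf-surjective , tilingOf-injective) , orbitCount-formula
  where open Orbits k
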